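{- There exists an infinite family of words $v$ such that $r_{\$}(v)/r(v)=\Theta(\log n)$, where $n=|v|$.
   Context: Words are over a finite ordered alphabet; $\$$ is an extra symbol smaller than all letters. For a word $w$, $\mathrm{BWT}(w)$ is obtained by sorting the conjugates $w[i..n-1]w[0..i-1]$ lexicographically and concatenating their last characters; $r(w)$ is the number of maximal equal-letter runs of $\mathrm{BWT}(w)$ and $r_{\$}(w)$ that of $\mathrm{BWT}(w\$)$. $\Theta$ is understood uniformly over the family. -}

module Defs where

open import Data.Nat using (ℕ; zero; suc; _+_)
open import Data.Nat.Properties using (_≟_)
import Data.Nat.Properties as ℕP
open import Data.Fin using (Fin; toℕ)
open import Data.List using (List; []; _∷_; _++_; take; drop; map; length; upTo)
import Data.List.Relation.Binary.Lex.NonStrict as LexNS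
open import Relation.Nullary using (yes; no)

-- To compare words over the alphabet extended with the sentinel $,
-- we encode letters as natural numbers: $ ↦ 0 and a letter a ↦ suc (toℕ a).
-- This preserves the letter order and makes $ smaller than every letter.

Word : ℕ → Set
Word σ = List (Fin σ)

encode : ∀ {σ} → Word σ → List ℕ
encode = map (λ a → suc (toℕ a))

withDollar : ∀ {σ} → Word σ → List ℕ
withDollar w = encode w ++ (0 ∷ [])

lexOrder = LexNS.≤-decTotalOrder ℕP.≤-decTotalOrder

open import Data.List.Sort.InsertionSort lexOrder using (sort)

rotation : ℕ → List ℕ → List ℕ
rotation i w = drop i w ++ take i w

conjugates : List ℕ → List (List ℕ)
conjugates w = map (λ i → rotation i w) (upTo (length w))

-- last character (only applied to nonempty lists)
lastChar : List ℕ → ℕ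
lastChar [] = 0
lastChar (x ∷ []) = x
lastChar (x ∷ y ∷ ys) = lastChar (y ∷ ys)

BWT : List ℕ → List ℕ
BWT w = map lastChar (sort (conjugates w))

runs' : ℕ → List ℕ → ℕ
runs' x [] = 1
runs' x (y ∷ ys) with x ≟ y
... | yes _ = runs' y ys
... | no  _ = suc (runs' y ys)

runs : List ℕ → ℕ
runs [] = 0
runs (x ∷ xs) = runs' x xs

r : ∀ {σ} → Word σ → ℕ
r w = runs (BWT (encode w))

r$ : ∀ {σ} → Word σ → ℕ
r$ w = runs (BWT (withDollar w))

-- For M ≥ 8 let p = F_M, q = F_{M+1} and n = p + q = F_{M+2}, and let v be the word of
-- length n coding the orbit of n − 1 under the rotation z ↦ z + p (mod n), with letter a on
-- [0, q) and b on [q, n).  Every conjugate of v is the coding read from another state, the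
-- lexicographic order of these codings is the order of their states, and the last letter is b
-- exactly for the states below p; hence BWT(v) = b^p a^q and r(v) = 2.
--
-- By d'Ocagne's identity F_{u+2} F_M ≡ (−1)^u F_{M−u} (mod F_{M+2}), the suffix of v of length
-- F_{u+2} − 1 starts in state p − (−1)^u F_{M−u} − 1.  So the conjugates X_u of v$ beginning with
-- these suffixes satisfy X_1 < X_2 < … < X_{M−2} and their last letters alternate with the parity
-- of u, whence r_$(v) ≥ M − 2.  Conversely, since the multiples m F_M with 0 < m < F_{i+1} stay at
-- distance at least F_{M+2−i} from 0 modulo F_{M+2}, the last letters of the sorted conjugates of
-- v$ agree with the two-run labelling "a iff at least the coding of length n from state p" except
-- at v$, at $v and at the conjugates beginning with a suffix of length F_{2k+1} − 1; whence
-- r_$(v) ≤ 2M + 12.  As ⌊M/2⌋ ≤ ⌊log₂ n⌋ ≤ M + 2, the ratio r_$(v)/r(v) is Θ(log n).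

{-# OPTIONS --safe #-}
module Submission where

open import Data.Bool using (Bool; true; false; not; if_then_else_)
open import Data.Empty using (⊥; ⊥-elim)
open import Data.Fin as Fin using (Fin)
open import Data.List using (List; []; _∷_; _++_; [_]; map; length; take; drop; upTo; applyUpTo)
import Data.List.Properties as List
open import Data.List.Membership.Propositional using (_∈_)
open import Data.List.Membership.Propositional.Properties
  using (∈-∃++; ∈-++⁻; ∈-++⁺ˡ; ∈-++⁺ʳ; ∈-map⁺; ∈-map⁻; ∈-upTo⁺; ∈-upTo⁻)
open import Data.List.Relation.Binary.Lex.NonStrict using (Lex-<; <-transitive; base; halt; this; next)
open import Data.List.Relation.Binary.Permutation.Propositional using (↭-sym)
open import Data.List.Relation.Binary.Permutation.Propositional.Properties using (∈-resp-↭; ↭-length)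
import Data.List.Relation.Binary.Permutation.Propositional.Properties as Permutation
open import Data.List.Relation.Binary.Pointwise using (Pointwise-≡⇒≡)
open import Data.List.Relation.Binary.Sublist.Propositional using (_⊆_; []; _∷_; _∷ʳ_)
import Data.List.Relation.Binary.Sublist.Propositional.Properties as Sublist
open import Data.List.Relation.Unary.All as All using (All; []; _∷_)
import Data.List.Relation.Unary.All.Properties as Allₚ
open import Data.List.Relation.Unary.AllPairs as AllPairs using (AllPairs; []; _∷_)
import Data.List.Relation.Unary.AllPairs.Properties as AllPairsₚ
open import Data.List.Relation.Unary.Any using (here; there)
open import Data.List.Relation.Unary.Linked as Linked using (Linked; []; [-]; _∷_)
open import Data.List.Relation.Unary.Linked.Properties using (Linked⇒AllPairs)
open import Data.Nat
open import Data.Nat.DivMod using (_%_; m<n⇒m%n≡m; [m+kn]%n≡m%n)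
open import Data.Nat.GeneralisedArithmetic using (iterate)
open import Data.Nat.ListAction using (sum)
open import Data.Nat.ListAction.Properties using (sum-++; sum-↭)
open import Data.Nat.Logarithm using (⌊log₂_⌋; ⌊log₂⌋-mono-≤; ⌊log₂[2^n]⌋≡n)
open import Data.Nat.Properties
open import Data.Nat.Tactic.RingSolver using (solve-∀)
open import Data.Product using (Σ; ∃; ∃₂; _×_; _,_)
open import Data.Sum using (_⊎_; inj₁; inj₂; [_,_]′; swap)
open import Data.Unit using (tt)
open import Function using (_∘_)
open import Relation.Binary.Bundles using (DecTotalOrder; Setoid)
open import Relation.Binary.PropositionalEquality hiding ([_])
import Relation.Binary.Reasoning.Setoid as SetoidReasoning
open import Relation.Nullary using (¬_; yes; no; Dec)

open import Defs
open import Data.List.Sort.InsertionSort lexOrder using (sort)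
open import Data.List.Sort.InsertionSort.Properties lexOrder using (sort-↭; sort-↗)

module Lexˡ = DecTotalOrder lexOrder

infix 4 _≤ˡ_ _<ˡ_

_≤ˡ_ : List ℕ → List ℕ → Set
_≤ˡ_ = Lexˡ._≤_

_<ˡ_ : List ℕ → List ℕ → Set
_<ˡ_ = Lex-< _≡_ _≤_

<ˡ⇒≤ˡ : ∀ {xs ys} → xs <ˡ ys → xs ≤ˡ ys
<ˡ⇒≤ˡ halt = halt
<ˡ⇒≤ˡ (this x<y) = this x<y
<ˡ⇒≤ˡ (next x≡y xs<ys) = next x≡y (<ˡ⇒≤ˡ xs<ys)

<ˡ-irrefl : ∀ {xs} → ¬ xs <ˡ xs
<ˡ-irrefl (this (_ , x≢x)) = x≢x refl
<ˡ-irrefl (next _ xs<xs) = <ˡ-irrefl xs<xs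

<ˡ-trans : ∀ {xs ys zs} → xs <ˡ ys → ys <ˡ zs → xs <ˡ zs
<ˡ-trans = <-transitive ≤-isPartialOrder

≤ˡ-antisym : ∀ {xs ys} → xs ≤ˡ ys → ys ≤ˡ xs → xs ≡ ys
≤ˡ-antisym xs≤ys ys≤xs = Pointwise-≡⇒≡ (Lexˡ.antisym xs≤ys ys≤xs)

≤ˡ⇒≯ˡ : ∀ {xs ys} → xs ≤ˡ ys → ¬ ys <ˡ xs
≤ˡ⇒≯ˡ xs≤ys ys<xs with ≤ˡ-antisym xs≤ys (<ˡ⇒≤ˡ ys<xs)
... | refl = <ˡ-irrefl ys<xs

Sortedˡ : List (List ℕ) → Set
Sortedˡ = Linked _≤ˡ_

sorted⇒allPairs : ∀ {xs} → Sortedˡ xs → AllPairs _≤ˡ_ xs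
sorted⇒allPairs = Linked⇒AllPairs Lexˡ.trans

sorted⇒strict : ∀ {xs} → Linked _<ˡ_ xs → AllPairs _<ˡ_ xs
sorted⇒strict = Linked⇒AllPairs <ˡ-trans

∈-∷⁻ : ∀ {A : Set} {w y : A} {ys} → w ∈ y ∷ ys → w ≢ y → w ∈ ys
∈-∷⁻ (here w≡y) w≢y = ⊥-elim (w≢y w≡y)
∈-∷⁻ (there w∈ys) _ = w∈ys

strictChain⇒⊆ : ∀ {xs ys} → Sortedˡ ys → Linked _<ˡ_ xs → All (_∈ ys) xs → xs ⊆ ys
strictChain⇒⊆ {[]} {[]} _ _ _ = []
strictChain⇒⊆ {[]} {y ∷ ys} ys↗ _ _ = y ∷ʳ strictChain⇒⊆ (Linked.tail ys↗) [] []
strictChain⇒⊆ {x ∷ xs} {y ∷ ys} ys↗ xs↗ (x∈y∷ys ∷ xs∈y∷ys) with x∈y∷ys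
... | here refl = refl ∷ strictChain⇒⊆ (Linked.tail ys↗) (Linked.tail xs↗) xs∈ys
  where
  xs∈ys : All (_∈ ys) xs
  xs∈ys = All.zipWith (λ (x<w , w∈) → ∈-∷⁻ w∈ λ { refl → <ˡ-irrefl x<w }) (AllPairs.head (sorted⇒strict xs↗) , xs∈y∷ys)
... | there x∈ys = y ∷ʳ strictChain⇒⊆ (Linked.tail ys↗) xs↗ (x∈ys ∷ xs∈ys)
  where
  xs∈ys : All (_∈ ys) xs
  xs∈ys = All.zipWith (λ (x<w , w∈) → ∈-∷⁻ w∈ λ { refl → ≤ˡ⇒≯ˡ (All.lookup (AllPairs.head (sorted⇒allPairs ys↗)) x∈ys) x<w })
                      (AllPairs.head (sorted⇒strict xs↗) , xs∈y∷ys)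

jump : ℕ → ℕ → ℕ
jump x y with x ≟ y
... | yes _ = 0
... | no  _ = 1

runs'-∷ : ∀ x y ys → runs' x (y ∷ ys) ≡ jump x y + runs' y ys
runs'-∷ x y ys with x ≟ y
... | yes _ = refl
... | no  _ = refl

jump-refl : ∀ x → jump x x ≡ 0
jump-refl x with x ≟ x
... | yes _ = refl
... | no x≢x = ⊥-elim (x≢x refl)

jump-≢ : ∀ {x y} → x ≢ y → jump x y ≡ 1
jump-≢ {x} {y} x≢y with x ≟ y
... | yes x≡y = ⊥-elim (x≢y x≡y)
... | no  _ = refl

jump≤1 : ∀ x y → jump x y ≤ 1
jump≤1 x y with x ≟ y
... | yes _ = z≤n
... | no  _ = s≤s z≤n

jump-sym : ∀ x y → jump x y ≡ jump y x
jump-sym x y with x ≟ y | y ≟ x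
... | yes _   | yes _   = refl
... | no  _   | no  _   = refl
... | yes x≡y | no  y≢x = ⊥-elim (y≢x (sym x≡y))
... | no  x≢y | yes y≡x = ⊥-elim (x≢y (sym y≡x))

jump-triangle : ∀ x y z → jump x z ≤ jump x y + jump y z
jump-triangle x y z with x ≟ y | y ≟ z | x ≟ z
... | _        | _        | yes _   = z≤n
... | yes refl | yes refl | no  x≢x = ⊥-elim (x≢x refl)
... | yes _    | no  _    | no  _   = ≤-refl
... | no  _    | _        | no  _   = s≤s z≤n

runs'≥1 : ∀ x xs → 1 ≤ runs' x xs
runs'≥1 x [] = ≤-refl
runs'≥1 x (y ∷ ys) rewrite runs'-∷ x y ys = ≤-trans (runs'≥1 y ys) (m≤n+m _ (jump x y))

0<length⇒0<runs : ∀ xs → 0 < length xs → 0 < runs xs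
0<length⇒0<runs (x ∷ xs) _ = runs'≥1 x xs

runs≤runs' : ∀ x xs → runs xs ≤ runs' x xs
runs≤runs' x [] = z≤n
runs≤runs' x (y ∷ ys) rewrite runs'-∷ x y ys = m≤n+m (runs' y ys) (jump x y)

runs'-∷-≥ : ∀ x y ys → runs' x ys ≤ runs' x (y ∷ ys)
runs'-∷-≥ x y [] rewrite runs'-∷ x y [] = m≤n+m 1 (jump x y)
runs'-∷-≥ x y (z ∷ zs)
  rewrite runs'-∷ x y (z ∷ zs) | runs'-∷ x z zs | runs'-∷ y z zs
        | sym (+-assoc (jump x y) (jump y z) (runs' z zs)) = +-monoˡ-≤ (runs' z zs) (jump-triangle x y z)

runs'-⊆ : ∀ x {xs ys} → xs ⊆ ys → runs' x xs ≤ runs' x ys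
runs'-⊆ x [] = ≤-refl
runs'-⊆ x (_∷_ {x = y} {xs = xs} {ys = ys} refl xs⊆ys)
  rewrite runs'-∷ x y xs | runs'-∷ x y ys = +-monoʳ-≤ (jump x y) (runs'-⊆ y xs⊆ys)
runs'-⊆ x (y ∷ʳ xs⊆ys) = ≤-trans (runs'-⊆ x xs⊆ys) (runs'-∷-≥ x y _)

runs-⊆ : ∀ {xs ys} → xs ⊆ ys → runs xs ≤ runs ys
runs-⊆ {[]} _ = z≤n
runs-⊆ (refl ∷ xs⊆ys) = runs'-⊆ _ xs⊆ys
runs-⊆ {_ ∷ _} (_∷ʳ_ {ys = ys} y xs⊆ys) = ≤-trans (runs-⊆ xs⊆ys) (runs≤runs' y ys)

mismatches : ∀ {A : Set} → (A → ℕ) → (A → ℕ) → List A → ℕ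
mismatches f g xs = sum (map (λ x → jump (f x) (g x)) xs)

runs'-map-≤-mismatches : ∀ {A : Set} (f g : A → ℕ) a b xs →
  runs' a (map f xs) ≤ jump a b + runs' b (map g xs) + 2 * mismatches f g xs
runs'-map-≤-mismatches f g a b [] = ≤-trans (m≤n+m 1 (jump a b)) (m≤m+n _ 0)
runs'-map-≤-mismatches f g a b (x ∷ xs)
  rewrite runs'-∷ a (f x) (map f xs) | runs'-∷ b (g x) (map g xs) =
  ≤-trans (+-mono-≤ jump-a-fx (runs'-map-≤-mismatches f g (f x) (g x) xs)) (≤-reflexive regroup)
  where
  jump-a-fx : jump a (f x) ≤ jump a b + jump b (g x) + jump (f x) (g x)
  jump-a-fx = ≤-trans (jump-triangle a (g x) (f x))
                (+-mono-≤ (jump-triangle a b (g x)) (≤-reflexive (jump-sym (g x) (f x))))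
  regroup : jump a b + jump b (g x) + jump (f x) (g x)
              + (jump (f x) (g x) + runs' (g x) (map g xs) + 2 * mismatches f g xs)
          ≡ jump a b + (jump b (g x) + runs' (g x) (map g xs)) + 2 * (jump (f x) (g x) + mismatches f g xs)
  regroup = +-regroup (jump a b) (jump b (g x)) (jump (f x) (g x)) (runs' (g x) (map g xs)) (mismatches f g xs)
    where
    +-regroup : ∀ a b d r m → a + b + d + (d + r + 2 * m) ≡ a + (b + r) + 2 * (d + m)
    +-regroup = solve-∀

runs-map-≤-mismatches : ∀ {A : Set} (f g : A → ℕ) xs →
  runs (map f xs) ≤ runs (map g xs) + 2 * mismatches f g xs
runs-map-≤-mismatches f g [] = z≤n
runs-map-≤-mismatches f g (x ∷ xs) =
  ≤-trans (runs'-map-≤-mismatches f g (f x) (g x) xs)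
          (≤-trans (m≤n+m _ (jump (f x) (g x))) (≤-reflexive regroup))
  where
  regroup : jump (f x) (g x) + (jump (f x) (g x) + runs' (g x) (map g xs) + 2 * mismatches f g xs)
          ≡ runs' (g x) (map g xs) + 2 * (jump (f x) (g x) + mismatches f g xs)
  regroup = +-regroup (jump (f x) (g x)) (runs' (g x) (map g xs)) (mismatches f g xs)
    where
    +-regroup : ∀ d r m → d + (d + r + 2 * m) ≡ r + 2 * (d + m)
    +-regroup = solve-∀

runs'-const : ∀ {x xs} → All (_≡ x) xs → runs' x xs ≡ 1
runs'-const [] = refl
runs'-const {x} {_ ∷ xs} (refl ∷ xs≡x) rewrite runs'-∷ x x xs | jump-refl x = runs'-const xs≡x

module _ {a b : ℕ} where

  private
    Label : ℕ → Set
    Label n = n ≡ a ⊎ n ≡ b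

    _⇝_ : ℕ → ℕ → Set
    m ⇝ n = n ≡ a → m ≡ a

  runs'-≢-twoBlocks : ∀ {x ns} → x ≢ a → Label x → All Label ns → All (x ⇝_) ns → runs' x ns ≡ 1
  runs'-≢-twoBlocks {x} x≢a x∈ab ns∈ab x⇝ns = runs'-const (All.zipWith only-b (ns∈ab , x⇝ns))
    where
    x≡b : x ≡ b
    x≡b = [ (λ x≡a → ⊥-elim (x≢a x≡a)) , (λ x≡b → x≡b) ]′ x∈ab
    only-b : ∀ {n} → Label n × x ⇝ n → n ≡ x
    only-b (inj₁ n≡a , x⇝n) = ⊥-elim (x≢a (x⇝n n≡a))
    only-b (inj₂ n≡b , _) = trans n≡b (sym x≡b)

  runs'-twoBlocks : ∀ {x ns} → Label x → All Label ns → All (x ⇝_) ns → AllPairs _⇝_ ns → runs' x ns ≤ 2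
  runs'-twoBlocks {x} x∈ab ns∈ab x⇝ns ns⇝ with x ≟ a
  ... | no x≢a = ≤-trans (≤-reflexive (runs'-≢-twoBlocks x≢a x∈ab ns∈ab x⇝ns)) (n≤1+n 1)
  runs'-twoBlocks {ns = []} _ _ _ _ | yes refl = s≤s z≤n
  runs'-twoBlocks {ns = y ∷ ys} _ (y∈ab ∷ ys∈ab) _ (y⇝ys ∷ ys⇝) | yes refl
    rewrite runs'-∷ a y ys with y ≟ a
  ... | yes refl rewrite jump-refl a = runs'-twoBlocks y∈ab ys∈ab y⇝ys ys⇝
  ... | no y≢a rewrite runs'-≢-twoBlocks y≢a y∈ab ys∈ab y⇝ys = +-monoˡ-≤ 1 (jump≤1 a y)

  runs-twoBlocks : ∀ {ns} → All Label ns → AllPairs _⇝_ ns → runs ns ≤ 2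
  runs-twoBlocks [] [] = z≤n
  runs-twoBlocks (x∈ab ∷ ns∈ab) (x⇝ns ∷ ns⇝) = runs'-twoBlocks x∈ab ns∈ab x⇝ns ns⇝

AllPairs-map-∈ : ∀ {A : Set} {R S : A → A → Set} {xs} →
  (∀ {y z} → y ∈ xs → z ∈ xs → R y z → S y z) → AllPairs R xs → AllPairs S xs
AllPairs-map-∈ R⇒S [] = []
AllPairs-map-∈ R⇒S (Rx ∷ Rxs) =
  All.tabulate (λ z∈ → R⇒S (here refl) (there z∈) (All.lookup Rx z∈))
  ∷ AllPairs-map-∈ (λ y∈ z∈ → R⇒S (there y∈) (there z∈)) Rxs

runs-map-sorted-twoValued : ∀ (g : List ℕ → ℕ) {a b xs} → Sortedˡ xs →
  (∀ {y} → y ∈ xs → g y ≡ a ⊎ g y ≡ b) →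
  (∀ {y z} → y ∈ xs → z ∈ xs → y ≤ˡ z → g z ≡ a → g y ≡ a) →
  runs (map g xs) ≤ 2
runs-map-sorted-twoValued g xs↗ labels monotone =
  runs-twoBlocks (Allₚ.map⁺ (All.tabulate labels))
                 (AllPairsₚ.map⁺ (AllPairs-map-∈ monotone (sorted⇒allPairs xs↗)))

sum-applyUpTo-suc : ∀ (φ : ℕ → ℕ) m → sum (applyUpTo φ (suc m)) ≡ sum (applyUpTo φ m) + φ m
sum-applyUpTo-suc φ m = begin
  sum (applyUpTo φ (suc m))             ≡⟨ cong sum (List.applyUpTo-∷ʳ φ m) ⟨
  sum (applyUpTo φ m ++ [ φ m ])        ≡⟨ sum-++ (applyUpTo φ m) [ φ m ] ⟩
  sum (applyUpTo φ m) + (φ m + 0)       ≡⟨ cong (sum (applyUpTo φ m) +_) (+-identityʳ (φ m)) ⟩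
  sum (applyUpTo φ m) + φ m             ∎
  where open ≡-Reasoning

sum-applyUpTo≤length : ∀ (φ : ℕ → ℕ) m {K} → (∀ i → φ i ≤ 1) →
  (∀ i → i < m → φ i ≡ 0 ⊎ i ∈ K) → sum (applyUpTo φ m) ≤ length K
sum-applyUpTo≤length φ zero _ _ = z≤n
sum-applyUpTo≤length φ (suc m) {K} φ≤1 support
  rewrite sum-applyUpTo-suc φ m with support m ≤-refl
... | inj₁ φm≡0 rewrite φm≡0 | +-identityʳ (sum (applyUpTo φ m)) =
  sum-applyUpTo≤length φ m φ≤1 (λ i i<m → support i (m<n⇒m<1+n i<m))
... | inj₂ m∈K with ∈-∃++ m∈K
...   | K₁ , K₂ , refl = begin
  sum (applyUpTo φ m) + φ m       ≤⟨ +-mono-≤ (sum-applyUpTo≤length φ m φ≤1 support′) (φ≤1 m) ⟩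
  length (K₁ ++ K₂) + 1           ≡⟨ cong (_+ 1) (List.length-++ K₁) ⟩
  length K₁ + length K₂ + 1       ≡⟨ +-assoc (length K₁) (length K₂) 1 ⟩
  length K₁ + (length K₂ + 1)     ≡⟨ cong (length K₁ +_) (+-comm (length K₂) 1) ⟩
  length K₁ + length (m ∷ K₂)     ≡⟨ List.length-++ K₁ ⟨
  length (K₁ ++ m ∷ K₂)           ∎
  where
  open ≤-Reasoning
  support′ : ∀ i → i < m → φ i ≡ 0 ⊎ i ∈ K₁ ++ K₂
  support′ i i<m with support i (m<n⇒m<1+n i<m)
  ... | inj₁ φi≡0 = inj₁ φi≡0
  ... | inj₂ i∈K with ∈-++⁻ K₁ i∈K
  ...   | inj₁ i∈K₁ = inj₂ (∈-++⁺ˡ i∈K₁)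
  ...   | inj₂ (here refl) = ⊥-elim (<-irrefl refl i<m)
  ...   | inj₂ (there i∈K₂) = inj₂ (∈-++⁺ʳ K₁ i∈K₂)

rotation-++ : ∀ (xs ys : List ℕ) → rotation (length xs) (xs ++ ys) ≡ ys ++ xs
rotation-++ xs ys = cong₂ _++_ (drop-++ xs) (take-++ xs)
  where
  drop-++ : ∀ xs → drop (length xs) (xs ++ ys) ≡ ys
  drop-++ [] = refl
  drop-++ (x ∷ xs) = drop-++ xs
  take-++ : ∀ xs → take (length xs) (xs ++ ys) ≡ xs
  take-++ [] = refl
  take-++ (x ∷ xs) = cong (x ∷_) (take-++ xs)

lastChar-++ : ∀ (xs : List ℕ) y ys → lastChar (xs ++ y ∷ ys) ≡ lastChar (y ∷ ys)
lastChar-++ [] y ys = refl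
lastChar-++ (x ∷ []) y ys = refl
lastChar-++ (x ∷ x′ ∷ xs) y ys = lastChar-++ (x′ ∷ xs) y ys

length-conjugates : ∀ w → length (conjugates w) ≡ length w
length-conjugates w = trans (List.length-map _ (upTo (length w))) (List.length-upTo (length w))

rotation∈sort-conjugates : ∀ {i} w → i < length w → rotation i w ∈ sort (conjugates w)
rotation∈sort-conjugates w i<|w| =
  ∈-resp-↭ (↭-sym (sort-↭ (conjugates w))) (∈-map⁺ (λ j → rotation j w) (∈-upTo⁺ i<|w|))

∈-sort-conjugates⁻ : ∀ {x} w → x ∈ sort (conjugates w) → ∃ λ i → i < length w × x ≡ rotation i w
∈-sort-conjugates⁻ w x∈ with ∈-map⁻ (λ j → rotation j w) (∈-resp-↭ (sort-↭ (conjugates w)) x∈)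
... | i , i∈ , x≡ = i , ∈-upTo⁻ i∈ , x≡

length-sort-conjugates : ∀ w → length (sort (conjugates w)) ≡ length w
length-sort-conjugates w = trans (↭-length (sort-↭ (conjugates w))) (length-conjugates w)

mismatches-sort-conjugates : ∀ (f g : List ℕ → ℕ) w →
  mismatches f g (sort (conjugates w)) ≡ sum (applyUpTo (λ i → jump (f (rotation i w)) (g (rotation i w))) (length w))
mismatches-sort-conjugates f g w = begin
  sum (map mismatch (sort (conjugates w)))                          ≡⟨ sum-↭ (Permutation.map⁺ mismatch (sort-↭ (conjugates w))) ⟩
  sum (map mismatch (map (λ i → rotation i w) (upTo (length w))))  ≡⟨ cong sum (List.map-∘ (upTo (length w))) ⟨
  sum (map (mismatch ∘ λ i → rotation i w) (upTo (length w)))      ≡⟨ cong sum (List.map-upTo _ (length w)) ⟩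
  sum (applyUpTo (mismatch ∘ λ i → rotation i w) (length w))       ∎
  where
  open ≡-Reasoning
  mismatch : List ℕ → ℕ
  mismatch x = jump (f x) (g x)

iterate-suc : ∀ {A : Set} (f : A → A) x s → iterate f x (suc s) ≡ f (iterate f x s)
iterate-suc f x zero = refl
iterate-suc f x (suc s) = iterate-suc f (f x) s

iterate-+ : ∀ {A : Set} (f : A → A) x s t → iterate f x (s + t) ≡ iterate f (iterate f x s) t
iterate-+ f x zero t = refl
iterate-+ f x (suc s) t = iterate-+ f (f x) s t

module Congruence (n : ℕ) where

  infix 4 _≈_

  _≈_ : ℕ → ℕ → Set
  a ≈ b = ∃₂ λ j k → a + j * n ≡ b + k * n

  ≈-reflexive : ∀ {a b} → a ≡ b → a ≈ b
  ≈-reflexive refl = 0 , 0 , refl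

  ≈-refl : ∀ {a} → a ≈ a
  ≈-refl = ≈-reflexive refl

  ≈-sym : ∀ {a b} → a ≈ b → b ≈ a
  ≈-sym (j , k , e) = k , j , sym e

  ≈-trans : ∀ {a b c} → a ≈ b → b ≈ c → a ≈ c
  ≈-trans {a} {b} {c} (j₁ , k₁ , e₁) (j₂ , k₂ , e₂) = j₁ + j₂ , k₂ + k₁ , (begin
    a + (j₁ + j₂) * n       ≡⟨ shuffle a j₁ j₂ n ⟩
    (a + j₁ * n) + j₂ * n   ≡⟨ cong (_+ j₂ * n) e₁ ⟩
    (b + k₁ * n) + j₂ * n   ≡⟨ exchange b k₁ j₂ n ⟩
    (b + j₂ * n) + k₁ * n   ≡⟨ cong (_+ k₁ * n) e₂ ⟩
    (c + k₂ * n) + k₁ * n   ≡⟨ shuffle c k₂ k₁ n ⟨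
    c + (k₂ + k₁) * n       ∎)
    where
    open ≡-Reasoning
    shuffle : ∀ a x y n → a + (x + y) * n ≡ a + x * n + y * n
    shuffle = solve-∀
    exchange : ∀ a x y n → a + x * n + y * n ≡ a + y * n + x * n
    exchange = solve-∀

  ≈-setoid : Setoid _ _
  ≈-setoid = record { _≈_ = _≈_ ; isEquivalence = record { refl = ≈-refl ; sym = ≈-sym ; trans = ≈-trans } }

  module ≈-Reasoning = SetoidReasoning ≈-setoid

  +-cong : ∀ {a b c d} → a ≈ b → c ≈ d → a + c ≈ b + d
  +-cong {a} {b} {c} {d} (j₁ , k₁ , e₁) (j₂ , k₂ , e₂) = j₁ + j₂ , k₁ + k₂ , (begin
    a + c + (j₁ + j₂) * n          ≡⟨ interchange a c j₁ j₂ n ⟩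
    (a + j₁ * n) + (c + j₂ * n)    ≡⟨ cong₂ _+_ e₁ e₂ ⟩
    (b + k₁ * n) + (d + k₂ * n)    ≡⟨ interchange b d k₁ k₂ n ⟨
    b + d + (k₁ + k₂) * n          ∎)
    where
    open ≡-Reasoning
    interchange : ∀ a c x y n → a + c + (x + y) * n ≡ (a + x * n) + (c + y * n)
    interchange = solve-∀

  +-congˡ : ∀ a {c d} → c ≈ d → a + c ≈ a + d
  +-congˡ a = +-cong (≈-refl {a})

  +-congʳ : ∀ {a b} c → a ≈ b → a + c ≈ b + c
  +-congʳ c a≈b = +-cong a≈b (≈-refl {c})

  +-cancelʳ-≈ : ∀ {a b} c → a + c ≈ b + c → a ≈ b
  +-cancelʳ-≈ {a} {b} c (j , k , e) = j , k , +-cancelʳ-≡ c _ _ (begin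
    a + j * n + c   ≡⟨ exchange a j n c ⟩
    a + c + j * n   ≡⟨ e ⟩
    b + c + k * n   ≡⟨ exchange b k n c ⟨
    b + k * n + c   ∎)
    where
    open ≡-Reasoning
    exchange : ∀ a j n c → a + j * n + c ≡ a + c + j * n
    exchange = solve-∀

  m*n≈0 : ∀ m → m * n ≈ 0
  m*n≈0 m = 0 , m , +-identityʳ (m * n)

  n≈0 : n ≈ 0
  n≈0 = 0 , 1 , refl

  ≈⇒≡ : ∀ {a b} → a < n → b < n → a ≈ b → a ≡ b
  ≈⇒≡ {a} {b} a<n b<n (j , k , e) = begin
    a                ≡⟨ m<n⇒m%n≡m a<n ⟨
    a % n            ≡⟨ [m+kn]%n≡m%n a j n ⟨
    (a + j * n) % n  ≡⟨ cong (_% n) e ⟩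
    (b + k * n) % n  ≡⟨ [m+kn]%n≡m%n b k n ⟩
    b % n            ≡⟨ m<n⇒m%n≡m b<n ⟩
    b                ∎
    where
    open ≡-Reasoning
    instance
      n≢0 : NonZero n
      n≢0 = >-nonZero (≤-<-trans z≤n a<n)

  ≈⇒≡n+ : ∀ {a b} → n ≤ a → a < n + n → b < n → a ≈ b → a ≡ n + b
  ≈⇒≡n+ {a} {b} n≤a a<2n b<n a≈b = begin
    a              ≡⟨ m+[n∸m]≡n n≤a ⟨
    n + (a ∸ n)    ≡⟨ cong (n +_) (≈⇒≡ a∸n<n b<n (≈-trans a∸n≈a a≈b)) ⟩
    n + b          ∎
    where
    open ≡-Reasoning
    a∸n<n : a ∸ n < n
    a∸n<n = subst (a ∸ n <_) (m+n∸m≡n n n) (∸-monoˡ-< a<2n n≤a)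
    a∸n≈a : a ∸ n ≈ a
    a∸n≈a = 1 , 0 , trans (cong (a ∸ n +_) (+-identityʳ n)) (trans (m∸n+n≡m n≤a) (sym (+-identityʳ a)))

  near-n-≉-far : ∀ {a r f f′} → f′ < f → f′ < n → n < a + f → a ≤ n + f′ → f ≤ r → r + f ≤ n → ¬ a ≈ r
  near-n-≉-far {a} {r} {f} {f′} f′<f f′<n n<a+f a≤n+f′ f≤r r+f≤n a≈r with a <? n
  ... | yes a<n = <⇒≱ n<a+f (subst (λ t → t + f ≤ n) (sym (≈⇒≡ a<n r<n a≈r)) r+f≤n)
    where
    r<n : r < n
    r<n = <-≤-trans (m<m+n r (≤-<-trans z≤n f′<f)) r+f≤n
  ... | no a≮n = <⇒≱ (<-≤-trans f′<f f≤r) (+-cancelˡ-≤ n r f′ (subst (_≤ n + f′) a≡n+r a≤n+f′))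
    where
    r<n : r < n
    r<n = <-≤-trans (m<m+n r (≤-<-trans z≤n f′<f)) r+f≤n
    a≡n+r : a ≡ n + r
    a≡n+r = ≈⇒≡n+ (≮⇒≥ a≮n) (≤-<-trans a≤n+f′ (+-monoʳ-< n f′<n)) r<n a≈r

module Rotation (p q : ℕ) where

  n : ℕ
  n = q + p

  open Congruence n public

  R : ℕ → ℕ
  R z with z <? q
  ... | yes _ = z + p
  ... | no  _ = z ∸ q

  -- letters are produced already encoded as in Defs: a ↦ 1, b ↦ 2
  letter : ℕ → ℕ
  letter z with z <? q
  ... | yes _ = 1
  ... | no  _ = 2

  R^ : ℕ → ℕ → ℕ
  R^ s z = iterate R z s

  coding : ℕ → ℕ → List ℕ
  coding zero    z = []
  coding (suc L) z = letter z ∷ coding L (R z)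

  letter-1or2 : ∀ z → letter z ≡ 1 ⊎ letter z ≡ 2
  letter-1or2 z with z <? q
  ... | yes _ = inj₁ refl
  ... | no  _ = inj₂ refl

  0<letter : ∀ z → 0 < letter z
  0<letter z with z <? q
  ... | yes _ = z<s
  ... | no  _ = z<s

  letter<q : ∀ {z} → z < q → letter z ≡ 1
  letter<q {z} z<q with z <? q
  ... | yes _ = refl
  ... | no z≮q = ⊥-elim (z≮q z<q)

  letter≥q : ∀ {z} → q ≤ z → letter z ≡ 2
  letter≥q {z} q≤z with z <? q
  ... | yes z<q = ⊥-elim (<⇒≱ z<q q≤z)
  ... | no  _ = refl

  letter-mono : ∀ {z z′} → z ≤ z′ → letter z ≤ letter z′
  letter-mono {z} {z′} z≤z′ with z <? q | z′ <? q
  ... | yes _  | yes _   = ≤-refl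
  ... | yes _  | no  _   = s≤s z≤n
  ... | no z≮q | yes z′<q = ⊥-elim (z≮q (≤-<-trans z≤z′ z′<q))
  ... | no  _  | no  _   = ≤-refl

  letter-≢⇒separated : ∀ {z z′} → z ≤ z′ → letter z ≢ letter z′ → z < q × q ≤ z′
  letter-≢⇒separated {z} {z′} z≤z′ ≢same with z <? q | z′ <? q
  ... | yes _   | yes _    = ⊥-elim (≢same refl)
  ... | yes z<q | no z′≮q  = z<q , ≮⇒≥ z′≮q
  ... | no z≮q  | yes z′<q = ⊥-elim (z≮q (≤-<-trans z≤z′ z′<q))
  ... | no  _   | no  _    = ⊥-elim (≢same refl)

  R-mono-sameLetter : ∀ {z z′} → z ≤ z′ → letter z ≡ letter z′ → R z ≤ R z′
  R-mono-sameLetter {z} {z′} z≤z′ same with z <? q | z′ <? q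
  ... | yes _  | yes _    = +-monoˡ-≤ p z≤z′
  ... | yes _  | no  _    with () ← same
  ... | no z≮q | yes z′<q = ⊥-elim (z≮q (≤-<-trans z≤z′ z′<q))
  ... | no  _  | no  _    = ∸-monoˡ-≤ q z≤z′

  R-+-sameLetter : ∀ z δ → letter z ≡ letter (z + δ) → R (z + δ) ≡ R z + δ
  R-+-sameLetter z δ same with z <? q | z + δ <? q
  ... | yes _  | yes _    = +-swapʳ z δ p
    where
    +-swapʳ : ∀ a b c → a + b + c ≡ a + c + b
    +-swapʳ = solve-∀
  ... | yes _  | no  _    with () ← same
  ... | no z≮q | yes z+δ<q = ⊥-elim (z≮q (≤-<-trans (m≤m+n z δ) z+δ<q))
  ... | no z≮q | no  _    = +-∸-comm δ (≮⇒≥ z≮q)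

  ∸q<p : ∀ {z} → q ≤ z → z < n → z ∸ q < p
  ∸q<p {z} q≤z z<n = subst (z ∸ q <_) (m+n∸m≡n q p) (∸-monoˡ-< z<n q≤z)

  R<n : ∀ {z} → z < n → R z < n
  R<n {z} z<n with z <? q
  ... | yes z<q = +-monoˡ-< p z<q
  ... | no z≮q  = <-≤-trans (∸q<p (≮⇒≥ z≮q) z<n) (m≤n+m p q)

  R≈ : ∀ {z} → z < n → R z ≈ z + p
  R≈ {z} z<n with z <? q
  ... | yes _  = ≈-refl
  ... | no z≮q = 1 , 0 , (begin
    z ∸ q + (q + p + 0)  ≡⟨ cong (z ∸ q +_) (+-identityʳ n) ⟩
    z ∸ q + (q + p)      ≡⟨ +-assoc (z ∸ q) q p ⟨
    z ∸ q + q + p        ≡⟨ cong (_+ p) (m∸n+n≡m (≮⇒≥ z≮q)) ⟩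
    z + p                ≡⟨ +-identityʳ (z + p) ⟨
    z + p + 0            ∎)
    where open ≡-Reasoning

  R^<n : ∀ s {z} → z < n → R^ s z < n
  R^<n zero    z<n = z<n
  R^<n (suc s) z<n = R^<n s (R<n z<n)

  R^≈ : ∀ s {z} → z < n → R^ s z ≈ z + s * p
  R^≈ zero    {z} _   = ≈-reflexive (sym (+-identityʳ z))
  R^≈ (suc s) {z} z<n = begin
    R^ s (R z)       ≈⟨ R^≈ s (R<n z<n) ⟩
    R z + s * p      ≈⟨ +-congʳ (s * p) (R≈ z<n) ⟩
    z + p + s * p    ≡⟨ +-assoc z p (s * p) ⟩
    z + (p + s * p)  ∎
    where open ≈-Reasoning

  R^-period : ∀ {z} → z < n → R^ n z ≡ z
  R^-period {z} z<n = ≈⇒≡ (R^<n n z<n) z<n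
    (≈-trans (R^≈ n z<n) (0 , p , trans (+-identityʳ (z + n * p)) (cong (z +_) (*-comm n p))))

  coding-+ : ∀ a b z → coding (a + b) z ≡ coding a z ++ coding b (R^ a z)
  coding-+ zero    b z = refl
  coding-+ (suc a) b z = cong (letter z ∷_) (coding-+ a b (R z))

  length-coding : ∀ L z → length (coding L z) ≡ L
  length-coding zero    z = refl
  length-coding (suc L) z = cong suc (length-coding L (R z))

  lastChar-coding : ∀ s z → lastChar (coding (suc s) z) ≡ letter (R^ s z)
  lastChar-coding zero    z = refl
  lastChar-coding (suc s) z = lastChar-coding s (R z)

  letter-R<p : ∀ {x} → x < n → R x < p → letter x ≡ 2
  letter-R<p {x} x<n Rx<p with x <? q
  ... | yes _ = ⊥-elim (<⇒≱ Rx<p (m≤n+m p x))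
  ... | no  _ = refl

  letter-R≥p : ∀ {x} → x < n → p ≤ R x → letter x ≡ 1
  letter-R≥p {x} x<n p≤Rx with x <? q
  ... | yes _  = refl
  ... | no x≮q = ⊥-elim (<⇒≱ (∸q<p (≮⇒≥ x≮q) x<n) p≤Rx)

  coding-mono : ∀ L {z z′} → z ≤ z′ → coding L z ≤ˡ coding L z′
  coding-mono zero    z≤z′ = base tt
  coding-mono (suc L) {z} {z′} z≤z′ with letter z ≟ letter z′
  ... | yes same = next same (coding-mono L (R-mono-sameLetter z≤z′ same))
  ... | no  diff = this (letter-mono z≤z′ , diff)

  coding-$-<ˡ : ∀ L L′ {z z′} X Y → z ≤ z′ → L < L′ → coding L z ++ 0 ∷ X <ˡ coding L′ z′ ++ Y
  coding-$-<ˡ zero (suc L′) {z′ = z′} X Y _ _ = this (z≤n , <⇒≢ (0<letter z′))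
  coding-$-<ˡ (suc L) (suc L′) {z} {z′} X Y z≤z′ (s≤s L<L′) with letter z ≟ letter z′
  ... | yes same = next same (coding-$-<ˡ L L′ X Y (R-mono-sameLetter z≤z′ same) L<L′)
  ... | no  diff = this (letter-mono z≤z′ , diff)

  Separated : ℕ → ℕ → ℕ → Set
  Separated L z δ = Σ ℕ λ s → s < L × R^ s z < q × q ≤ R^ s z + δ

  coding-<ˡ-separated : ∀ L z δ X Y → Separated L z δ → coding L z ++ X <ˡ coding L (z + δ) ++ Y
  coding-<ˡ-separated (suc L) z δ X Y (s , s<L , lo , hi) with letter z ≟ letter (z + δ)
  ... | no diff = this (letter-mono (m≤m+n z δ) , diff)
  coding-<ˡ-separated (suc L) z δ X Y (zero , _ , lo , hi) | yes same =
    ⊥-elim (1≢2 (trans (sym (letter<q lo)) (trans same (letter≥q hi))))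
    where
    1≢2 : 1 ≢ 2
    1≢2 ()
  coding-<ˡ-separated (suc L) z δ X Y (suc s , s≤s s<L , lo , hi) | yes same
    rewrite R-+-sameLetter z δ same = next same (coding-<ˡ-separated L (R z) δ X Y (s , s<L , lo , hi))

  coding-≡-¬separated : ∀ L z δ → ¬ Separated L z δ → coding L z ≡ coding L (z + δ)
  coding-≡-¬separated zero    z δ _ = refl
  coding-≡-¬separated (suc L) z δ ¬sep with letter z ≟ letter (z + δ)
  ... | yes same rewrite R-+-sameLetter z δ same =
    cong₂ _∷_ same (coding-≡-¬separated L (R z) δ λ (s , s<L , sep) → ¬sep (suc s , s≤s s<L , sep))
  ... | no diff = ⊥-elim (¬sep (0 , z<s , letter-≢⇒separated (m≤m+n z δ) diff))

  coding-letters : ∀ L z → All (λ x → x ≡ 1 ⊎ x ≡ 2) (coding L z)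
  coding-letters zero    z = []
  coding-letters (suc L) z = letter-1or2 z ∷ coding-letters L (R z)

fib : ℕ → ℕ
fib 0 = 0
fib 1 = 1
fib (suc (suc k)) = fib (suc k) + fib k

fib-≤-suc : ∀ k → fib k ≤ fib (suc k)
fib-≤-suc zero    = z≤n
fib-≤-suc (suc k) = m≤m+n (fib (suc k)) (fib k)

fib-mono : ∀ {a b} → a ≤ b → fib a ≤ fib b
fib-mono {a} {b} a≤b = subst (λ x → fib a ≤ fib x) (m∸n+n≡m a≤b) (go (b ∸ a))
  where
  go : ∀ c → fib a ≤ fib (c + a)
  go zero    = ≤-refl
  go (suc c) = ≤-trans (go c) (fib-≤-suc (c + a))

0<fib-suc : ∀ k → 0 < fib (suc k)
0<fib-suc zero    = z<s
0<fib-suc (suc k) = ≤-trans (0<fib-suc k) (m≤m+n _ _)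

0<fib : ∀ {k} → 0 < k → 0 < fib k
0<fib {suc k} _ = 0<fib-suc k

fib-double : ∀ k → fib k + fib k ≤ fib (2 + k)
fib-double k = +-monoˡ-≤ (fib k) (fib-≤-suc k)

fib-<-suc : ∀ {k} → 2 ≤ k → fib k < fib (suc k)
fib-<-suc {suc zero} (s≤s ())
fib-<-suc {suc (suc k)} _ = m<m+n (fib (suc (suc k))) (0<fib-suc k)

fib-strictMono : ∀ {a b} → 2 ≤ a → a < b → fib a < fib b
fib-strictMono {a} {suc b} 2≤a a<1+b with m≤n⇒m<n∨m≡n (≤-pred a<1+b)
... | inj₁ a<b  = <-trans (fib-strictMono 2≤a a<b) (fib-<-suc (≤-trans 2≤a (<⇒≤ a<b)))
... | inj₂ refl = fib-<-suc 2≤a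

fib-<-fib : ∀ {a b} → 3 ≤ b → a < b → fib a < fib b
fib-<-fib {zero}  3≤b _   = 0<fib (≤-trans z<s 3≤b)
fib-<-fib {suc zero} 3≤b _ = fib-strictMono (s≤s (s≤s z≤n)) 3≤b
fib-<-fib {suc (suc a)} _ a<b = fib-strictMono (s≤s (s≤s z≤n)) a<b

fib-cancel-< : ∀ {a b} → fib a < fib b → a < b
fib-cancel-< {a} {b} fa<fb with a <? b
... | yes a<b = a<b
... | no a≮b  = ⊥-elim (<⇒≱ fa<fb (fib-mono (≮⇒≥ a≮b)))

fib≤2^ : ∀ j → fib j ≤ 2 ^ j
fib≤2^ zero          = z≤n
fib≤2^ (suc zero)    = s≤s z≤n
fib≤2^ (suc (suc j)) = begin
  fib (suc j) + fib j     ≤⟨ +-mono-≤ (fib≤2^ (suc j)) (≤-trans (fib≤2^ j) (m≤m+n (2 ^ j) (2 ^ j + 0))) ⟩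
  2 ^ suc j + 2 ^ suc j   ≡⟨ cong (2 ^ suc j +_) (+-identityʳ (2 ^ suc j)) ⟨
  2 ^ suc (suc j)         ∎
  where open ≤-Reasoning

2^≤fib : ∀ j → 2 ^ j ≤ fib (2 + (j + j))
2^≤fib zero    = s≤s z≤n
2^≤fib (suc j) rewrite +-suc j j = begin
  2 ^ j + (2 ^ j + 0)                          ≡⟨ cong (2 ^ j +_) (+-identityʳ (2 ^ j)) ⟩
  2 ^ j + 2 ^ j                                ≤⟨ +-mono-≤ (≤-trans (2^≤fib j) (fib-≤-suc (2 + (j + j)))) (2^≤fib j) ⟩
  fib (3 + (j + j)) + fib (2 + (j + j))        ∎
  where open ≤-Reasoning

⌊log₂fib⌋≤ : ∀ j → ⌊log₂ fib j ⌋ ≤ j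
⌊log₂fib⌋≤ j = subst (⌊log₂ fib j ⌋ ≤_) (⌊log₂[2^n]⌋≡n j) (⌊log₂⌋-mono-≤ (fib≤2^ j))

⌊n/2⌋≤⌊log₂fib[2+n]⌋ : ∀ m → ⌊ m /2⌋ ≤ ⌊log₂ fib (2 + m) ⌋
⌊n/2⌋≤⌊log₂fib[2+n]⌋ m = subst (_≤ ⌊log₂ fib (2 + m) ⌋) (⌊log₂[2^n]⌋≡n h)
  (⌊log₂⌋-mono-≤ (≤-trans (2^≤fib h) (fib-mono (s≤s (s≤s h+h≤m)))))
  where
  h = ⌊ m /2⌋
  h+h≤m : h + h ≤ m
  h+h≤m = ≤-trans (+-monoʳ-≤ h (⌊n/2⌋≤⌈n/2⌉ m)) (≤-reflexive (⌊n/2⌋+⌈n/2⌉≡n m))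

fib-bracket : ∀ m → 0 < m → ∃ λ k → fib (1 + (k + k)) ≤ m × m < fib (3 + (k + k))
fib-bracket (suc zero)    _ = 0 , ≤-refl , s≤s (s≤s z≤n)
fib-bracket (suc (suc m)) _ with fib-bracket (suc m) z<s
... | k , lo , hi with suc (suc m) <? fib (3 + (k + k))
...   | yes m<F = k , m≤n⇒m≤1+n lo , m<F
...   | no m≮F  = suc k , lo′ , hi′
  where
  m≡F : suc (suc m) ≡ fib (3 + (k + k))
  m≡F = ≤-antisym hi (≮⇒≥ m≮F)
  lo′ : fib (1 + (suc k + suc k)) ≤ suc (suc m)
  lo′ rewrite +-suc k k = ≤-reflexive (sym m≡F)
  hi′ : suc (suc m) < fib (3 + (suc k + suc k))
  hi′ rewrite +-suc k k | m≡F = fib-strictMono (s≤s (s≤s z≤n)) (m<n+m (3 + (k + k)) {2} z<s)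

even : ℕ → Bool
even zero    = true
even (suc k) = not (even k)

even-double : ∀ k → even (k + k) ≡ true
even-double zero = refl
even-double (suc k) rewrite +-suc k k | even-double k = refl

dOcagne⁺ dOcagne⁻ : ℕ → ℕ → Set
dOcagne⁺ u b = fib (2 + u) * fib (u + b) ≡ fib u * fib (2 + (u + b)) + fib b
dOcagne⁻ u b = fib (2 + u) * fib (u + b) + fib b ≡ fib u * fib (2 + (u + b))

fib-dOcagne-step : ∀ u v → fib (3 + u) * fib (1 + v) + fib (2 + u) * fib v ≡ fib (1 + u) * fib (3 + v) + fib u * fib (2 + v)
fib-dOcagne-step u v = identity (fib u) (fib (1 + u)) (fib v) (fib (1 + v))
  where
  identity : ∀ a₀ a₁ b₀ b₁ → (a₁ + a₀ + a₁) * b₁ + (a₁ + a₀) * b₀ ≡ a₁ * (b₁ + b₀ + b₁) + a₀ * (b₁ + b₀)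
  identity = solve-∀

fib-dOcagne : ∀ u b → if even u then dOcagne⁺ u b else dOcagne⁻ u b
fib-dOcagne zero b = *-identityˡ (fib b)
fib-dOcagne (suc u) b with even u | fib-dOcagne u b
... | true | e = +-cancelʳ-≡ (fib u * fib (2 + (u + b))) _ _ (begin
  fib (3 + u) * fib (1 + (u + b)) + fib b + fib u * fib (2 + (u + b))
    ≡⟨ +-assoc (fib (3 + u) * fib (1 + (u + b))) (fib b) _ ⟩
  fib (3 + u) * fib (1 + (u + b)) + (fib b + fib u * fib (2 + (u + b)))
    ≡⟨ cong (fib (3 + u) * fib (1 + (u + b)) +_) (trans (+-comm (fib b) _) (sym e)) ⟩
  fib (3 + u) * fib (1 + (u + b)) + fib (2 + u) * fib (u + b)
    ≡⟨ fib-dOcagne-step u (u + b) ⟩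
  fib (1 + u) * fib (3 + (u + b)) + fib u * fib (2 + (u + b))  ∎)
  where open ≡-Reasoning
... | false | e = +-cancelʳ-≡ (fib (2 + u) * fib (u + b)) _ _ (begin
  fib (3 + u) * fib (1 + (u + b)) + fib (2 + u) * fib (u + b)
    ≡⟨ fib-dOcagne-step u (u + b) ⟩
  fib (1 + u) * fib (3 + (u + b)) + fib u * fib (2 + (u + b))
    ≡⟨ cong (fib (1 + u) * fib (3 + (u + b)) +_) e ⟨
  fib (1 + u) * fib (3 + (u + b)) + (fib (2 + u) * fib (u + b) + fib b)
    ≡⟨ cong (fib (1 + u) * fib (3 + (u + b)) +_) (+-comm _ (fib b)) ⟩
  fib (1 + u) * fib (3 + (u + b)) + (fib b + fib (2 + u) * fib (u + b))
    ≡⟨ +-assoc (fib (1 + u) * fib (3 + (u + b))) (fib b) _ ⟨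
  fib (1 + u) * fib (3 + (u + b)) + fib b + fib (2 + u) * fib (u + b)  ∎)
  where open ≡-Reasoning

fib-dOcagne⊎ : ∀ u b → dOcagne⁺ u b ⊎ dOcagne⁻ u b
fib-dOcagne⊎ u b with even u | fib-dOcagne u b
... | true  | e = inj₁ e
... | false | e = inj₂ e

module Multiples (M : ℕ) where

  p n : ℕ
  p = fib M
  n = fib (2 + M)

  FarFromZero : ℕ → ℕ → Set
  FarFromZero b m = Σ ℕ λ j → Σ ℕ λ r → m * p ≡ j * n + r × fib b ≤ r × r + fib b ≤ n

  far-weaken : ∀ {b m} → FarFromZero (suc b) m → FarFromZero b m
  far-weaken {b} (j , r , e , lo , hi) =
    j , r , e , ≤-trans (fib-≤-suc b) lo , ≤-trans (+-monoʳ-≤ r (fib-≤-suc b)) hi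

  dOcagne⁺-at : ∀ u b → u + b ≡ M → dOcagne⁺ u b → fib (2 + u) * p ≡ fib u * n + fib b
  dOcagne⁺-at u b refl e = e

  dOcagne⁻-at : ∀ u b → u + b ≡ M → dOcagne⁻ u b → fib (2 + u) * p + fib b ≡ fib u * n
  dOcagne⁻-at u b refl e = e

  2fib≤n : ∀ {b} → b ≤ M → fib b + fib b ≤ n
  2fib≤n {b} b≤M = ≤-trans (fib-double b) (fib-mono (s≤s (s≤s b≤M)))

  far-of-⁻ : ∀ {m b} c → m * p + fib b ≡ c * n → fib b + fib b ≤ n → FarFromZero b m
  far-of-⁻ {m} {b} zero e 2F≤n =
    0 , 0 , m+n≡0⇒m≡0 (m * p) e , ≤-reflexive (m+n≡0⇒n≡0 (m * p) e) , ≤-trans (m≤m+n (fib b) (fib b)) 2F≤n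
  far-of-⁻ {m} {b} (suc j) e 2F≤n = j , n ∸ fib b , +-cancelʳ-≡ (fib b) _ _ (begin
    m * p + fib b              ≡⟨ e ⟩
    n + j * n                  ≡⟨ +-comm n (j * n) ⟩
    j * n + n                  ≡⟨ cong (j * n +_) (m∸n+n≡m F≤n) ⟨
    j * n + (n ∸ fib b + fib b) ≡⟨ +-assoc (j * n) (n ∸ fib b) (fib b) ⟨
    j * n + (n ∸ fib b) + fib b ∎) , F≤n∸F , ≤-reflexive (m∸n+n≡m F≤n)
    where
    open ≡-Reasoning
    F≤n : fib b ≤ n
    F≤n = ≤-trans (m≤m+n (fib b) (fib b)) 2F≤n
    F≤n∸F : fib b ≤ n ∸ fib b
    F≤n∸F = +-cancelʳ-≤ (fib b) (fib b) (n ∸ fib b) (subst (fib b + fib b ≤_) (sym (m∸n+n≡m F≤n)) 2F≤n)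

  far-Fib : ∀ u b → u + b ≡ M → FarFromZero b (fib (2 + u))
  far-Fib u b u+b≡M with fib-dOcagne⊎ u b
  ... | inj₁ e = fib u , fib b , dOcagne⁺-at u b u+b≡M e , ≤-refl , 2fib≤n b≤M
    where b≤M = subst (b ≤_) u+b≡M (m≤n+m b u)
  ... | inj₂ e = far-of-⁻ {fib (2 + u)} {b} (fib u) (dOcagne⁻-at u b u+b≡M e) (2fib≤n b≤M)
    where b≤M = subst (b ≤_) u+b≡M (m≤n+m b u)

  far-Fib+ : ∀ u b {m} → u + b ≡ M → FarFromZero (2 + b) m → FarFromZero b (fib (2 + u) + m)
  far-Fib+ u b {m} u+b≡M (j , r , e , lo , hi) with fib-dOcagne⊎ u b
  ... | inj₁ e⁺ = fib u + j , r + fib b , (begin-equality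
    (fib (2 + u) + m) * p               ≡⟨ *-distribʳ-+ p (fib (2 + u)) m ⟩
    fib (2 + u) * p + m * p             ≡⟨ cong₂ _+_ (dOcagne⁺-at u b u+b≡M e⁺) e ⟩
    fib u * n + fib b + (j * n + r)     ≡⟨ regroup (fib u) n (fib b) j r ⟩
    (fib u + j) * n + (r + fib b)       ∎) , m≤n+m (fib b) r , (begin
    r + fib b + fib b                   ≡⟨ +-assoc r (fib b) (fib b) ⟩
    r + (fib b + fib b)                 ≤⟨ +-monoʳ-≤ r (fib-double b) ⟩
    r + fib (2 + b)                     ≤⟨ hi ⟩
    n                                   ∎)
    where
    open ≤-Reasoning
    regroup : ∀ a n c j r → a * n + c + (j * n + r) ≡ (a + j) * n + (r + c)
    regroup = solve-∀
  ... | inj₂ e⁻ = fib u + j , r ∸ fib b , +-cancelʳ-≡ (fib b) _ _ (begin-equality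
    (fib (2 + u) + m) * p + fib b            ≡⟨ regroup₁ (fib (2 + u)) m p (fib b) ⟩
    (fib (2 + u) * p + fib b) + m * p        ≡⟨ cong₂ _+_ (dOcagne⁻-at u b u+b≡M e⁻) e ⟩
    fib u * n + (j * n + r)                  ≡⟨ cong (λ x → fib u * n + (j * n + x)) (m∸n+n≡m F≤r) ⟨
    fib u * n + (j * n + (r ∸ fib b + fib b)) ≡⟨ regroup₂ (fib u) n j (r ∸ fib b) (fib b) ⟩
    (fib u + j) * n + (r ∸ fib b) + fib b    ∎) , F≤r∸F , (begin
    r ∸ fib b + fib b                        ≡⟨ m∸n+n≡m F≤r ⟩
    r                                        ≤⟨ m≤m+n r (fib (2 + b)) ⟩
    r + fib (2 + b)                          ≤⟨ hi ⟩
    n                                        ∎)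
    where
    open ≤-Reasoning
    regroup₁ : ∀ a m p c → (a + m) * p + c ≡ (a * p + c) + m * p
    regroup₁ = solve-∀
    regroup₂ : ∀ a n j s c → a * n + (j * n + (s + c)) ≡ (a + j) * n + s + c
    regroup₂ = solve-∀
    2F≤r : fib b + fib b ≤ r
    2F≤r = ≤-trans (fib-double b) lo
    F≤r : fib b ≤ r
    F≤r = ≤-trans (m≤m+n (fib b) (fib b)) 2F≤r
    F≤r∸F : fib b ≤ r ∸ fib b
    F≤r∸F = +-cancelʳ-≤ (fib b) (fib b) (r ∸ fib b) (subst (fib b + fib b ≤_) (sym (m∸n+n≡m F≤r)) 2F≤r)

  Far : ℕ → Set
  Far i = ∀ b → i + b ≡ 2 + M → ∀ {m} → 0 < m → m < fib (1 + i) → FarFromZero b m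

  far-step : ∀ i → Far i → Far (1 + i) → Far (2 + i)
  far-step i far-i far-1+i b i+b≡M+2 {m} 0<m m<F with m <? fib (2 + i)
  ... | yes m<F′ = far-weaken {b} {m} (far-1+i (suc b) (trans (+-suc (suc i) b) i+b≡M+2) 0<m m<F′)
  ... | no m≮F′ = subst (FarFromZero b) (m+[n∸m]≡n (≮⇒≥ m≮F′)) (far-Fib+m (m ∸ fib (2 + i)) m′<F)
    where
    m′<F : m ∸ fib (2 + i) < fib (1 + i)
    m′<F = +-cancelˡ-< (fib (2 + i)) _ _ (subst (_< fib (2 + i) + fib (1 + i)) (sym (m+[n∸m]≡n (≮⇒≥ m≮F′))) m<F)
    i+b≡M : i + b ≡ M
    i+b≡M = suc-injective (suc-injective i+b≡M+2)
    far-Fib+m : ∀ m′ → m′ < fib (1 + i) → FarFromZero b (fib (2 + i) + m′)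
    far-Fib+m zero    _ = subst (FarFromZero b) (sym (+-identityʳ (fib (2 + i)))) (far-Fib i b i+b≡M)
    far-Fib+m (suc k) k<F = far-Fib+ i b i+b≡M (far-i (2 + b) i+2+b≡M+2 z<s k<F)
      where
      i+2+b≡M+2 : i + (2 + b) ≡ 2 + M
      i+2+b≡M+2 = trans (+-suc i (suc b)) (cong suc (trans (+-suc i b) (cong suc i+b≡M)))

  far : ∀ i → Far i
  far zero          b _ {suc m} _ (s≤s ())
  far (suc zero)    b _ {suc m} _ (s≤s ())
  far (suc (suc i)) = far-step i (far i) (far (suc i))

n≤1+2⌊n/2⌋ : ∀ m → m ≤ suc (⌊ m /2⌋ + ⌊ m /2⌋)
n≤1+2⌊n/2⌋ zero = z≤n
n≤1+2⌊n/2⌋ (suc zero) = ≤-refl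
n≤1+2⌊n/2⌋ (suc (suc m)) rewrite +-suc ⌊ m /2⌋ ⌊ m /2⌋ = s≤s (s≤s (n≤1+2⌊n/2⌋ m))

[2+M]*2≤4*[M∸2] : ∀ {M} → 6 ≤ M → (2 + M) * 2 ≤ 4 * (M ∸ 2)
[2+M]*2≤4*[M∸2] (s≤s (s≤s (s≤s (s≤s (s≤s (s≤s {n = t} z≤n)))))) = begin
  (8 + t) * 2     ≡⟨ lhs t ⟩
  16 + t * 2      ≤⟨ +-mono-≤ (≤-refl {16}) (*-monoʳ-≤ t (s≤s (s≤s z≤n))) ⟩
  16 + t * 4      ≡⟨ rhs t ⟩
  4 * (4 + t)     ∎
  where
  open ≤-Reasoning
  lhs : ∀ t → (8 + t) * 2 ≡ 16 + t * 2
  lhs = solve-∀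
  rhs : ∀ t → 16 + t * 4 ≡ 4 * (4 + t)
  rhs = solve-∀

2+2*[5+M]≤8*⌊M/2⌋ : ∀ {M} → 8 ≤ M → 2 + 2 * (5 + M) ≤ 8 * ⌊ M /2⌋
2+2*[5+M]≤8*⌊M/2⌋ (s≤s (s≤s (s≤s (s≤s (s≤s (s≤s (s≤s (s≤s {n = t} z≤n)))))))) = begin
  2 + 2 * (13 + t)                   ≤⟨ +-monoʳ-≤ 2 (*-monoʳ-≤ 2 (+-monoʳ-≤ 13 (n≤1+2⌊n/2⌋ t))) ⟩
  2 + 2 * (13 + suc (h + h))       ≡⟨ lhs h ⟩
  30 + 4 * h                         ≤⟨ +-mono-≤ (m≤m+n 30 2) (*-monoˡ-≤ h (m≤m+n 4 4)) ⟩
  32 + 8 * h                         ≡⟨ rhs h ⟩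
  8 * (4 + h)                        ∎
  where
  open ≤-Reasoning
  h = ⌊ t /2⌋
  lhs : ∀ h → 2 + 2 * (13 + suc (h + h)) ≡ 30 + 4 * h
  lhs = solve-∀
  rhs : ∀ h → 32 + 8 * h ≡ 8 * (4 + h)
  rhs = solve-∀

toFin2 : ℕ → Fin 2
toFin2 1 = Fin.zero
toFin2 _ = Fin.suc Fin.zero

encode-map-toFin2 : ∀ {xs} → All (λ x → x ≡ 1 ⊎ x ≡ 2) xs → encode (map toFin2 xs) ≡ xs
encode-map-toFin2 [] = refl
encode-map-toFin2 (inj₁ refl ∷ xs∈) = cong (1 ∷_) (encode-map-toFin2 xs∈)
encode-map-toFin2 (inj₂ refl ∷ xs∈) = cong (2 ∷_) (encode-map-toFin2 xs∈)

module FibonacciWord (M : ℕ) (8≤M : 8 ≤ M) where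

  p q : ℕ
  p = fib M
  q = fib (suc M)

  open Rotation p q public
  open Multiples M using (FarFromZero; far; dOcagne⁺-at; dOcagne⁻-at)

  fib<p : ∀ {b} → b < M → fib b < p
  fib<p = fib-<-fib (≤-trans (s≤s (s≤s (s≤s z≤n))) 8≤M)

  0<p : 0 < p
  0<p = fib<p {0} (≤-trans z<s 8≤M)

  p<q : p < q
  p<q = fib-<-suc (≤-trans (s≤s (s≤s z≤n)) 8≤M)

  p<n : p < n
  p<n = <-≤-trans p<q (m≤m+n q p)

  0<n : 0 < n
  0<n = <-trans 0<p p<n

  p+fib<n : ∀ {b} → b ≤ M → p + fib b < n
  p+fib<n {b} b≤M = subst (p + fib b <_) (+-comm p q) (+-monoʳ-< p (≤-<-trans (fib-mono b≤M) p<q))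

  fib≤n : ∀ {u} → u ≤ M → fib (2 + u) ≤ n
  fib≤n u≤M = fib-mono (s≤s (s≤s u≤M))

  c : ℕ
  c = n ∸ 1

  c+1≡n : c + 1 ≡ n
  c+1≡n = m∸n+n≡m 0<n

  c<n : c < n
  c<n = subst (c <_) c+1≡n (m<m+n c z<s)

  V W : List ℕ
  V = coding n c
  W = V ++ [ 0 ]

  length-W : length W ≡ suc n
  length-W = trans (List.length-++ V) (trans (cong (_+ 1) (length-coding n c)) (+-comm n 1))

  Lw : List (List ℕ)
  Lw = sort (conjugates W)

  R^c+1+ℓp≈0 : ∀ i ℓ → i + ℓ ≡ n → R^ i c + 1 + ℓ * p ≈ 0
  R^c+1+ℓp≈0 i ℓ i+ℓ≡n = begin
    R^ i c + 1 + ℓ * p       ≈⟨ +-congʳ (ℓ * p) (+-congʳ 1 (R^≈ i c<n)) ⟩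
    c + i * p + 1 + ℓ * p    ≡⟨ regroup c i p ℓ ⟩
    c + 1 + (i + ℓ) * p      ≡⟨ cong₂ (λ x y → x + y * p) c+1≡n i+ℓ≡n ⟩
    n + n * p                ≡⟨ cong (n +_) (*-comm n p) ⟩
    (1 + p) * n              ≈⟨ m*n≈0 (1 + p) ⟩
    0                        ∎
    where
    open ≈-Reasoning
    regroup : ∀ c i p ℓ → c + i * p + 1 + ℓ * p ≡ c + 1 + (i + ℓ) * p
    regroup = solve-∀

  rotation-W : ∀ i ℓ → i + ℓ ≡ n → rotation i W ≡ coding ℓ (R^ i c) ++ 0 ∷ coding i c
  rotation-W i ℓ i+ℓ≡n = begin
    rotation i W
      ≡⟨ cong (λ L → rotation i (coding L c ++ [ 0 ])) (sym i+ℓ≡n) ⟩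
    rotation i (coding (i + ℓ) c ++ [ 0 ])
      ≡⟨ cong (λ w → rotation i (w ++ [ 0 ])) (coding-+ i ℓ c) ⟩
    rotation i ((coding i c ++ coding ℓ (R^ i c)) ++ [ 0 ])
      ≡⟨ cong (rotation i) (List.++-assoc (coding i c) _ _) ⟩
    rotation i (coding i c ++ coding ℓ (R^ i c) ++ [ 0 ])
      ≡⟨ cong (λ j → rotation j (coding i c ++ coding ℓ (R^ i c) ++ [ 0 ])) (length-coding i c) ⟨
    rotation (length (coding i c)) (coding i c ++ coding ℓ (R^ i c) ++ [ 0 ])
      ≡⟨ rotation-++ (coding i c) _ ⟩
    (coding ℓ (R^ i c) ++ [ 0 ]) ++ coding i c
      ≡⟨ List.++-assoc (coding ℓ (R^ i c)) [ 0 ] (coding i c) ⟩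
    coding ℓ (R^ i c) ++ 0 ∷ coding i c  ∎
    where open ≡-Reasoning

  lastChar-rotation-W : ∀ i ℓ → suc i + ℓ ≡ n → lastChar (rotation (suc i) W) ≡ letter (R^ i c)
  lastChar-rotation-W i ℓ e = begin
    lastChar (rotation (suc i) W)                                 ≡⟨ cong lastChar (rotation-W (suc i) ℓ e) ⟩
    lastChar (coding ℓ (R^ (suc i) c) ++ 0 ∷ coding (suc i) c)    ≡⟨ lastChar-++ (coding ℓ (R^ (suc i) c)) 0 (coding (suc i) c) ⟩
    lastChar (coding (suc i) c)                                   ≡⟨ lastChar-coding i c ⟩
    letter (R^ i c)                                               ∎
    where open ≡-Reasoning

  lastChar-rotation-W-<p : ∀ i ℓ → i + ℓ ≡ n → 0 < i → R^ i c < p → lastChar (rotation i W) ≡ 2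
  lastChar-rotation-W-<p (suc i) ℓ e _ R^c<p =
    trans (lastChar-rotation-W i ℓ e) (letter-R<p (R^<n i c<n) (subst (_< p) (iterate-suc R c i) R^c<p))

  lastChar-rotation-W-≥p : ∀ i ℓ → i + ℓ ≡ n → 0 < i → p ≤ R^ i c → lastChar (rotation i W) ≡ 1
  lastChar-rotation-W-≥p (suc i) ℓ e _ p≤R^c =
    trans (lastChar-rotation-W i ℓ e) (letter-R≥p (R^<n i c<n) (subst (p ≤_) (iterate-suc R c i) p≤R^c))

  Lv : List (List ℕ)
  Lv = sort (conjugates V)

  rotation-V : ∀ i → i < n → rotation i V ≡ coding n (R^ i c)
  rotation-V i i<n = begin
    rotation i V                                                ≡⟨ cong (λ L → rotation i (coding L c)) (sym i+ℓ≡n) ⟩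
    rotation i (coding (i + ℓ) c)                               ≡⟨ cong (rotation i) (coding-+ i ℓ c) ⟩
    rotation i (coding i c ++ coding ℓ y)                       ≡⟨ cong (λ j → rotation j (coding i c ++ coding ℓ y)) (length-coding i c) ⟨
    rotation (length (coding i c)) (coding i c ++ coding ℓ y)   ≡⟨ rotation-++ (coding i c) (coding ℓ y) ⟩
    coding ℓ y ++ coding i c                                    ≡⟨ cong (λ z → coding ℓ y ++ coding i z) R^ℓy≡c ⟨
    coding ℓ y ++ coding i (R^ ℓ y)                             ≡⟨ coding-+ ℓ i y ⟨
    coding (ℓ + i) y                                            ≡⟨ cong (λ L → coding L y) (trans (+-comm ℓ i) i+ℓ≡n) ⟩
    coding n y                                                  ∎
    where
    open ≡-Reasoning
    ℓ = n ∸ i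
    y = R^ i c
    i+ℓ≡n : i + ℓ ≡ n
    i+ℓ≡n = m+[n∸m]≡n (<⇒≤ i<n)
    R^ℓy≡c : R^ ℓ y ≡ c
    R^ℓy≡c = trans (sym (iterate-+ R c i ℓ)) (trans (cong (λ s → R^ s c) i+ℓ≡n) (R^-period c<n))

  ∈Lv⁻ : ∀ {x} → x ∈ Lv → ∃ λ y → y < n × x ≡ coding n y
  ∈Lv⁻ x∈ with ∈-sort-conjugates⁻ V x∈
  ... | i , i<|V| , refl = R^ i c , R^<n i c<n , rotation-V i i<n
    where
    i<n : i < n
    i<n = subst (i <_) (length-coding n c) i<|V|

  lastChar-coding-n : ∀ {y} → y < n → lastChar (coding n y) ≡ letter (R^ c y)
  lastChar-coding-n {y} y<n = trans (cong (λ L → lastChar (coding L y)) (trans (sym c+1≡n) (+-comm c 1))) (lastChar-coding c y)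

  R-R^c : ∀ {y} → y < n → R (R^ c y) ≡ y
  R-R^c {y} y<n = trans (sym (iterate-suc R y c)) (trans (cong (λ s → R^ s y) (trans (+-comm 1 c) c+1≡n)) (R^-period y<n))

  lastChar-coding-n-<p : ∀ {y} → y < n → y < p → lastChar (coding n y) ≡ 2
  lastChar-coding-n-<p y<n y<p = trans (lastChar-coding-n y<n) (letter-R<p (R^<n c y<n) (subst (_< p) (sym (R-R^c y<n)) y<p))

  lastChar-coding-n-≥p : ∀ {y} → y < n → p ≤ y → lastChar (coding n y) ≡ 1
  lastChar-coding-n-≥p y<n p≤y = trans (lastChar-coding-n y<n) (letter-R≥p (R^<n c y<n) (subst (p ≤_) (sym (R-R^c y<n)) p≤y))

  r≤2 : runs (map lastChar Lv) ≤ 2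
  r≤2 = runs-map-sorted-twoValued lastChar (sort-↗ (conjugates V)) labels monotone
    where
    labels : ∀ {x} → x ∈ Lv → lastChar x ≡ 2 ⊎ lastChar x ≡ 1
    labels x∈ with ∈Lv⁻ x∈
    ... | y , y<n , refl = swap (subst (λ a → a ≡ 1 ⊎ a ≡ 2) (sym (lastChar-coding-n y<n)) (letter-1or2 _))
    monotone : ∀ {x x′} → x ∈ Lv → x′ ∈ Lv → x ≤ˡ x′ → lastChar x′ ≡ 2 → lastChar x ≡ 2
    monotone x∈ x′∈ x≤x′ last-x′≡2 with ∈Lv⁻ x∈ | ∈Lv⁻ x′∈
    ... | y , y<n , refl | y′ , y′<n , refl with y <? p | y′ <? p
    ...   | yes y<p | _        = lastChar-coding-n-<p y<n y<p
    ...   | no _    | no y′≮p  with () ← trans (sym (lastChar-coding-n-≥p y′<n (≮⇒≥ y′≮p))) last-x′≡2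
    ...   | no y≮p  | yes y′<p = trans (cong lastChar (≤ˡ-antisym x≤x′ (coding-mono n (<⇒≤ (<-≤-trans y′<p (≮⇒≥ y≮p)))))) last-x′≡2

  0<r : 0 < runs (map lastChar Lv)
  0<r = 0<length⇒0<runs (map lastChar Lv)
          (subst (0 <_) (sym (trans (List.length-map lastChar Lv) (trans (length-sort-conjugates V) (length-coding n c)))) 0<n)

  ℓₓ iₓ zₓ : ℕ → ℕ
  ℓₓ u = fib (2 + u) ∸ 1
  iₓ u = n ∸ ℓₓ u
  zₓ u = R^ (iₓ u) c

  X : ℕ → List ℕ
  X u = rotation (iₓ u) W

  ℓₓ+1 : ∀ u → ℓₓ u + 1 ≡ fib (2 + u)
  ℓₓ+1 u = m∸n+n≡m (0<fib-suc (suc u))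

  ℓₓ<n : ∀ {u} → u ≤ M → ℓₓ u < n
  ℓₓ<n {u} u≤M = <-≤-trans (subst (ℓₓ u <_) (ℓₓ+1 u) (m<m+n (ℓₓ u) z<s)) (fib≤n u≤M)

  iₓ+ℓₓ : ∀ {u} → u ≤ M → iₓ u + ℓₓ u ≡ n
  iₓ+ℓₓ u≤M = m∸n+n≡m (<⇒≤ (ℓₓ<n u≤M))

  0<iₓ : ∀ {u} → u ≤ M → 0 < iₓ u
  0<iₓ u≤M = m<n⇒0<n∸m (ℓₓ<n u≤M)

  ℓₓ-<-suc : ∀ u → ℓₓ u < ℓₓ (suc u)
  ℓₓ-<-suc u = +-cancelʳ-< 1 (ℓₓ u) (ℓₓ (suc u))
    (subst₂ _<_ (sym (ℓₓ+1 u)) (sym (ℓₓ+1 (suc u))) (fib-<-suc {2 + u} (s≤s (s≤s z≤n))))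

  X≡ : ∀ {u} → u ≤ M → X u ≡ coding (ℓₓ u) (zₓ u) ++ 0 ∷ coding (iₓ u) c
  X≡ {u} u≤M = rotation-W (iₓ u) (ℓₓ u) (iₓ+ℓₓ u≤M)

  zₓ+1+fib*p≈p : ∀ {u} → u ≤ M → zₓ u + 1 + fib (2 + u) * p ≈ p
  zₓ+1+fib*p≈p {u} u≤M = begin
    zₓ u + 1 + fib (2 + u) * p          ≡⟨ cong (λ x → zₓ u + 1 + x * p) (ℓₓ+1 u) ⟨
    zₓ u + 1 + (ℓₓ u + 1) * p           ≡⟨ regroup (zₓ u) (ℓₓ u) p ⟩
    zₓ u + 1 + ℓₓ u * p + p             ≈⟨ +-congʳ p (R^c+1+ℓp≈0 (iₓ u) (ℓₓ u) (iₓ+ℓₓ u≤M)) ⟩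
    p                                   ∎
    where
    open ≈-Reasoning
    regroup : ∀ z ℓ p → z + 1 + (ℓ + 1) * p ≡ z + 1 + ℓ * p + p
    regroup = solve-∀

  fib*p≈⁺ : ∀ u b → u + b ≡ M → dOcagne⁺ u b → fib (2 + u) * p ≈ fib b
  fib*p≈⁺ u b u+b≡M e = begin
    fib (2 + u) * p       ≡⟨ dOcagne⁺-at u b u+b≡M e ⟩
    fib u * n + fib b     ≈⟨ +-congʳ (fib b) (m*n≈0 (fib u)) ⟩
    fib b                 ∎
    where open ≈-Reasoning

  fib*p≈⁻ : ∀ u b → u + b ≡ M → dOcagne⁻ u b → fib (2 + u) * p + fib b ≈ 0
  fib*p≈⁻ u b u+b≡M e = ≈-trans (≈-reflexive (dOcagne⁻-at u b u+b≡M e)) (m*n≈0 (fib u))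

  z+1+x≈p⇒≡ : ∀ {z x} → z < n → x < p → z + 1 + x ≈ p → z + 1 + x ≡ p
  z+1+x≈p⇒≡ {z} {x} z<n x<p z+1+x≈p with z + 1 + x <? n
  ... | yes z+1+x<n = ≈⇒≡ z+1+x<n p<n z+1+x≈p
  ... | no z+1+x≮n = ⊥-elim (<⇒≢ z+1+x<n+p (≈⇒≡n+ (≮⇒≥ z+1+x≮n) z+1+x<2n p<n z+1+x≈p))
    where
    z+1+x<n+p : z + 1 + x < n + p
    z+1+x<n+p = +-mono-≤-< (subst (_≤ n) (+-comm 1 z) z<n) x<p
    z+1+x<2n : z + 1 + x < n + n
    z+1+x<2n = <-≤-trans z+1+x<n+p (+-monoʳ-≤ n (<⇒≤ p<n))

  z+1≈y⇒≡ : ∀ {z y} → z < n → y < n → 0 < y → z + 1 ≈ y → z + 1 ≡ y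
  z+1≈y⇒≡ {z} {y} z<n y<n 0<y z+1≈y with z + 1 <? n
  ... | yes z+1<n = ≈⇒≡ z+1<n y<n z+1≈y
  ... | no z+1≮n = ⊥-elim (<⇒≢ 0<y (sym y≡0))
    where
    y≡0 : y ≡ 0
    y≡0 = ≈⇒≡ y<n 0<n (begin
      y      ≈⟨ ≈-sym z+1≈y ⟩
      z + 1  ≡⟨ ≤-antisym (subst (_≤ n) (+-comm 1 z) z<n) (≮⇒≥ z+1≮n) ⟩
      n      ≈⟨ n≈0 ⟩
      0      ∎)
      where open ≈-Reasoning

  ChainState : ℕ → ℕ → Set
  ChainState u b = (even u ≡ true × zₓ u + 1 + fib b ≡ p) ⊎ (even u ≡ false × zₓ u + 1 ≡ p + fib b)

  chainState : ∀ u b → u + b ≡ M → 0 < u → 0 < b → ChainState u b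
  chainState u b u+b≡M 0<u 0<b with even u | fib-dOcagne u b
  ... | true | e = inj₁ (refl , z+1+x≈p⇒≡ (R^<n (iₓ u) c<n) (fib<p b<M) (begin
    zₓ u + 1 + fib b                   ≈⟨ +-congˡ (zₓ u + 1) (≈-sym (fib*p≈⁺ u b u+b≡M e)) ⟩
    zₓ u + 1 + fib (2 + u) * p         ≈⟨ zₓ+1+fib*p≈p u≤M ⟩
    p                                  ∎))
    where
    open ≈-Reasoning
    u≤M = subst (u ≤_) u+b≡M (m≤m+n u b)
    b<M = subst (b <_) u+b≡M (+-monoˡ-≤ b 0<u)
  ... | false | e = inj₂ (refl , z+1≈y⇒≡ (R^<n (iₓ u) c<n) (p+fib<n b≤M) (≤-trans 0<p (m≤m+n p (fib b))) (begin
    zₓ u + 1                                 ≡⟨ +-identityʳ (zₓ u + 1) ⟨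
    zₓ u + 1 + 0                             ≈⟨ +-congˡ (zₓ u + 1) (fib*p≈⁻ u b u+b≡M e) ⟨
    zₓ u + 1 + (fib (2 + u) * p + fib b)     ≡⟨ +-assoc (zₓ u + 1) (fib (2 + u) * p) (fib b) ⟨
    zₓ u + 1 + fib (2 + u) * p + fib b       ≈⟨ +-congʳ (fib b) (zₓ+1+fib*p≈p u≤M) ⟩
    p + fib b                                ∎))
    where
    open ≈-Reasoning
    u≤M = subst (u ≤_) u+b≡M (m≤m+n u b)
    b≤M = subst (b ≤_) u+b≡M (m≤n+m b u)

  X-<ˡ-suc-even : ∀ u b → suc u + b ≡ M → 0 < b →
    zₓ u + 1 + fib (suc b) ≡ p → zₓ (suc u) + 1 ≡ p + fib b → X u <ˡ X (suc u)
  X-<ˡ-suc-even u b 1+u+b≡M 0<b e₀ e₁ =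
    subst₂ _<ˡ_ (sym (X≡ (<⇒≤ 1+u≤M))) (sym (X≡ 1+u≤M))
      (coding-$-<ˡ (ℓₓ u) (ℓₓ (suc u)) _ _ (<⇒≤ (<-≤-trans zₓu<p p≤zₓ1+u)) (ℓₓ-<-suc u))
    where
    1+u≤M : suc u ≤ M
    1+u≤M = subst (suc u ≤_) 1+u+b≡M (m≤m+n (suc u) b)
    zₓu<p : zₓ u < p
    zₓu<p = subst (zₓ u <_) e₀ (subst (_≤ zₓ u + 1 + fib (suc b)) (+-comm (zₓ u) 1) (m≤m+n (zₓ u + 1) (fib (suc b))))
    p≤zₓ1+u : p ≤ zₓ (suc u)
    p≤zₓ1+u = +-cancelʳ-≤ 1 p (zₓ (suc u)) (subst (p + 1 ≤_) (sym e₁) (+-monoʳ-≤ p (0<fib 0<b)))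

  R^-¬separated : ∀ {u b′ y} s → suc u + b′ ≡ M → 2 ≤ b′ → y < n → y + 1 + fib b′ ≡ p →
    2 + s < fib (3 + u) → ¬ (R^ s y < q × q ≤ R^ s y + fib (2 + b′))
  R^-¬separated {u} {b′} {y} s 1+u+b′≡M 2≤b′ y<n e 2+s<F (x<q , q≤x+F) =
    contradiction (far (2 + u) b 2+u+b≡2+M z<s 2+s<F)
    where
    x = R^ s y
    b = suc b′
    U = x + p + 1 + fib b′
    2+u+b≡2+M : 2 + u + b ≡ 2 + M
    2+u+b≡2+M = cong (2 +_) (trans (+-suc u b′) 1+u+b′≡M)
    U≈[2+s]p : U ≈ (2 + s) * p
    U≈[2+s]p = begin
      x + p + 1 + fib b′                ≈⟨ +-congʳ (fib b′) (+-congʳ 1 (+-congʳ p (R^≈ s y<n))) ⟩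
      y + s * p + p + 1 + fib b′        ≡⟨ regroup y (s * p) p (fib b′) ⟩
      (y + 1 + fib b′) + s * p + p      ≡⟨ cong (λ t → t + s * p + p) e ⟩
      p + s * p + p                     ≡⟨ regroup′ p s ⟩
      (2 + s) * p                       ∎
      where
      open ≈-Reasoning
      regroup : ∀ y sp p f → y + sp + p + 1 + f ≡ y + 1 + f + sp + p
      regroup = solve-∀
      regroup′ : ∀ p s → p + s * p + p ≡ (2 + s) * p
      regroup′ = solve-∀
    U≈r : ∀ {J r} → (2 + s) * p ≡ J * n + r → U ≈ r
    U≈r {J} {r} eJ = ≈-trans U≈[2+s]p (0 , J , trans (+-identityʳ _) (trans eJ (+-comm (J * n) r)))
    n<U+F : n < U + fib b
    n<U+F = subst (_≤ U + fib b) (+-comm n 1)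
              (subst (n + 1 ≤_) (regroup x (fib b) (fib b′) p) (+-monoˡ-≤ 1 (+-monoˡ-≤ p q≤x+F)))
      where
      regroup : ∀ x f f′ p → x + (f + f′) + p + 1 ≡ x + p + 1 + f′ + f
      regroup = solve-∀
    U≤n+F′ : U ≤ n + fib b′
    U≤n+F′ = +-monoˡ-≤ (fib b′) (subst (_≤ n) (+-comm 1 (x + p)) (+-monoˡ-< p x<q))
    F′<n : fib b′ < n
    F′<n = <-trans (fib<p (subst (b′ <_) 1+u+b′≡M (m<n+m b′ z<s))) p<n
    contradiction : FarFromZero b (2 + s) → ⊥
    contradiction (J , r , eJ , F≤r , r+F≤n) =
      near-n-≉-far (fib-<-suc 2≤b′) F′<n n<U+F U≤n+F′ F≤r r+F≤n (U≈r {J} eJ)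

  X-<ˡ-suc-odd : ∀ u b′ → suc u + b′ ≡ M → 2 ≤ b′ →
    zₓ u + 1 ≡ p + fib (suc b′) → zₓ (suc u) + 1 + fib b′ ≡ p → X u <ˡ X (suc u)
  X-<ˡ-suc-odd u b′ 1+u+b′≡M 2≤b′ e₀ e₁ =
    subst₂ _<ˡ_ (sym (trans (X≡ (<⇒≤ 1+u≤M)) (cong (_++ 0 ∷ coding (iₓ u) c) agree))) (sym (X≡ 1+u≤M))
      (coding-$-<ˡ (ℓₓ u) (ℓₓ (suc u)) _ _ ≤-refl (ℓₓ-<-suc u))
    where
    y = zₓ (suc u)
    1+u≤M : suc u ≤ M
    1+u≤M = subst (suc u ≤_) 1+u+b′≡M (m≤m+n (suc u) b′)
    zₓu≡y+F : zₓ u ≡ y + fib (2 + b′)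
    zₓu≡y+F = +-cancelʳ-≡ 1 _ _ (begin
      zₓ u + 1                         ≡⟨ e₀ ⟩
      p + fib (suc b′)                 ≡⟨ cong (_+ fib (suc b′)) e₁ ⟨
      y + 1 + fib b′ + fib (suc b′)    ≡⟨ regroup y (fib b′) (fib (suc b′)) ⟩
      y + (fib (suc b′) + fib b′) + 1  ∎)
      where
      open ≡-Reasoning
      regroup : ∀ y f f′ → y + 1 + f + f′ ≡ y + (f′ + f) + 1
      regroup = solve-∀
    ¬separated : ¬ Separated (ℓₓ u) y (fib (2 + b′))
    ¬separated (s , s<ℓ , sep) = R^-¬separated s 1+u+b′≡M 2≤b′ (R^<n (iₓ (suc u)) c<n) e₁ 2+s<F sep
      where
      2+s<F : 2 + s < fib (3 + u)
      2+s<F = ≤-<-trans (subst (2 + s ≤_) (trans (+-comm 1 (ℓₓ u)) (ℓₓ+1 u)) (s≤s s<ℓ))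
                        (fib-<-suc {2 + u} (s≤s (s≤s z≤n)))
    agree : coding (ℓₓ u) (zₓ u) ≡ coding (ℓₓ u) y
    agree = trans (cong (coding (ℓₓ u)) zₓu≡y+F) (sym (coding-≡-¬separated (ℓₓ u) y _ ¬separated))

  X-<ˡ-suc : ∀ u b → u + suc b ≡ M → 0 < u → 2 ≤ b → X u <ˡ X (suc u)
  X-<ˡ-suc u b u+1+b≡M 0<u 2≤b =
    fromStates (chainState u (suc b) u+1+b≡M 0<u z<s) (chainState (suc u) b 1+u+b≡M z<s 0<b)
    where
    1+u+b≡M : suc u + b ≡ M
    1+u+b≡M = trans (sym (+-suc u b)) u+1+b≡M
    0<b : 0 < b
    0<b = ≤-trans (s≤s z≤n) 2≤b
    fromStates : ChainState u (suc b) → ChainState (suc u) b → X u <ˡ X (suc u)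
    fromStates (inj₁ (_ , e₀)) (inj₂ (_ , e₁)) = X-<ˡ-suc-even u b 1+u+b≡M 0<b e₀ e₁
    fromStates (inj₂ (_ , e₀)) (inj₁ (_ , e₁)) = X-<ˡ-suc-odd u b 1+u+b≡M 2≤b e₀ e₁
    fromStates (inj₁ (even-u , _)) (inj₁ (even-1+u , _)) with () ← trans (sym (cong not even-u)) even-1+u
    fromStates (inj₂ (odd-u , _))  (inj₂ (odd-1+u , _))  with () ← trans (sym (cong not odd-u)) odd-1+u

  lastChar-X : ∀ u b → u + b ≡ M → 0 < u → 0 < b → lastChar (X u) ≡ (if even u then 2 else 1)
  lastChar-X u b u+b≡M 0<u 0<b with chainState u b u+b≡M 0<u 0<b
  ... | inj₁ (even-u , e) rewrite even-u =
    lastChar-rotation-W-<p (iₓ u) (ℓₓ u) (iₓ+ℓₓ u≤M) (0<iₓ u≤M)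
      (subst (zₓ u <_) e (subst (_≤ zₓ u + 1 + fib b) (+-comm (zₓ u) 1) (m≤m+n (zₓ u + 1) (fib b))))
    where
    u≤M = subst (u ≤_) u+b≡M (m≤m+n u b)
  ... | inj₂ (odd-u , e) rewrite odd-u =
    lastChar-rotation-W-≥p (iₓ u) (ℓₓ u) (iₓ+ℓₓ u≤M) (0<iₓ u≤M)
      (+-cancelʳ-≤ 1 p (zₓ u) (subst (p + 1 ≤_) (sym e) (+-monoʳ-≤ p (0<fib 0<b))))
    where
    u≤M = subst (u ≤_) u+b≡M (m≤m+n u b)

  label-alternates : ∀ e → (if e then 2 else 1) ≢ (if not e then 2 else 1)
  label-alternates true  ()
  label-alternates false ()

  chain : ℕ → ℕ → List (List ℕ)
  chain u zero    = []
  chain u (suc k) = X u ∷ chain (suc u) k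

  chain-<ˡ : ∀ k u b → u + b ≡ M → 0 < u → k + 2 ≤ b → Linked _<ˡ_ (chain u (suc k))
  chain-<ˡ zero    u b       _ _ _ = [-]
  chain-<ˡ (suc k) u (suc b) u+1+b≡M 0<u (s≤s k+2≤b) =
    X-<ˡ-suc u b u+1+b≡M 0<u (≤-trans (m≤n+m 2 k) k+2≤b)
    ∷ chain-<ˡ k (suc u) b (trans (sym (+-suc u b)) u+1+b≡M) z<s k+2≤b

  runs-chain : ∀ k u b → u + b ≡ M → 0 < u → k + 1 ≤ b → runs (map lastChar (chain u (suc k))) ≡ suc k
  runs-chain zero    u b       _ _ _ = refl
  runs-chain (suc k) u (suc b) u+1+b≡M 0<u (s≤s k+1≤b)
    rewrite runs'-∷ (lastChar (X u)) (lastChar (X (suc u))) (map lastChar (chain (suc (suc u)) k))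
          | runs-chain k (suc u) b (trans (sym (+-suc u b)) u+1+b≡M) z<s k+1≤b
          | lastChar-X u (suc b) u+1+b≡M 0<u z<s
          | lastChar-X (suc u) b (trans (sym (+-suc u b)) u+1+b≡M) z<s (≤-trans (m≤n+m 1 k) k+1≤b)
          | jump-≢ (label-alternates (even u)) = refl

  chain-∈ : ∀ u k → All (_∈ Lw) (chain u k)
  chain-∈ u zero    = []
  chain-∈ u (suc k) = rotation∈sort-conjugates W (subst (iₓ u <_) (sym length-W) (s≤s (m∸n≤m n (ℓₓ u))))
                    ∷ chain-∈ (suc u) k

  M∸2≤r$ : M ∸ 2 ≤ runs (map lastChar Lw)
  M∸2≤r$ = begin
    M ∸ 2                                       ≡⟨ cong (_∸ 2) 3+k≡M ⟨
    suc k                                       ≡⟨ runs-chain k 1 (M ∸ 1) 1+[M∸1]≡M z<s k+1≤M∸1 ⟨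
    runs (map lastChar (chain 1 (suc k)))       ≤⟨ runs-⊆ (Sublist.map⁺ lastChar chain⊆Lw) ⟩
    runs (map lastChar Lw)                      ∎
    where
    open ≤-Reasoning
    k = M ∸ 3
    1+[M∸1]≡M : 1 + (M ∸ 1) ≡ M
    1+[M∸1]≡M = m+[n∸m]≡n (≤-trans (s≤s z≤n) 8≤M)
    3+k≡M : 3 + k ≡ M
    3+k≡M = m+[n∸m]≡n (≤-trans (s≤s (s≤s (s≤s z≤n))) 8≤M)
    k+2≤M∸1 : k + 2 ≤ M ∸ 1
    k+2≤M∸1 = ≤-reflexive (trans (+-comm k 2) (cong (_∸ 1) 3+k≡M))
    k+1≤M∸1 : k + 1 ≤ M ∸ 1
    k+1≤M∸1 = ≤-trans (+-monoʳ-≤ k (n≤1+n 1)) k+2≤M∸1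
    chain⊆Lw = strictChain⇒⊆ (sort-↗ (conjugates W)) (chain-<ˡ k 1 (M ∸ 1) 1+[M∸1]≡M z<s k+2≤M∸1) (chain-∈ 1 (suc k))

  R^c+1+r≡n+p+fib : ∀ {i ℓ u b m″ J r} → i + ℓ ≡ n → p ≤ R^ i c → u + b ≡ M → dOcagne⁻ u b →
    ℓ + 1 ≡ fib (2 + u) + m″ → m″ * p ≡ J * n + r → fib b ≤ r → r < n → R^ i c + 1 + r ≡ n + p + fib b
  R^c+1+r≡n+p+fib {i} {ℓ} {u} {b} {m″} {J} {r} i+ℓ≡n p≤z u+b≡M e⁻ ℓ+1≡A+m″ eJ F≤r r<n =
    trans (cong (z + 1 +_) (sym (m∸n+n≡m F≤r)))
          (trans (sym (+-assoc (z + 1) ρ (fib b))) (cong (_+ fib b) z+1+ρ≡n+p))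
    where
    z = R^ i c
    ρ = r ∸ fib b
    [ℓ+1]p+F≈r : (ℓ + 1) * p + fib b ≈ r
    [ℓ+1]p+F≈r = begin
      (ℓ + 1) * p + fib b                       ≡⟨ cong (λ t → t * p + fib b) ℓ+1≡A+m″ ⟩
      (fib (2 + u) + m″) * p + fib b            ≡⟨ regroup (fib (2 + u)) m″ p (fib b) ⟩
      (fib (2 + u) * p + fib b) + m″ * p        ≈⟨ +-cong (fib*p≈⁻ u b u+b≡M e⁻) (0 , J , trans (+-identityʳ _) (trans eJ (+-comm (J * n) r))) ⟩
      r                                         ∎
      where
      open ≈-Reasoning
      regroup : ∀ a m p f → (a + m) * p + f ≡ (a * p + f) + m * p
      regroup = solve-∀
    z+1+ρ≈p : z + 1 + ρ ≈ p
    z+1+ρ≈p = begin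
      z + 1 + ρ                ≈⟨ +-congˡ (z + 1) (+-cancelʳ-≈ (fib b) (≈-trans [ℓ+1]p+F≈r (≈-reflexive (sym (m∸n+n≡m F≤r))))) ⟨
      z + 1 + (ℓ + 1) * p      ≡⟨ regroup z ℓ p ⟩
      z + 1 + ℓ * p + p        ≈⟨ +-congʳ p (R^c+1+ℓp≈0 i ℓ i+ℓ≡n) ⟩
      p                        ∎
      where
      open ≈-Reasoning
      regroup : ∀ z ℓ p → z + 1 + (ℓ + 1) * p ≡ z + 1 + ℓ * p + p
      regroup = solve-∀
    p<z+1+ρ : p < z + 1 + ρ
    p<z+1+ρ = ≤-trans (s≤s p≤z) (subst (_≤ z + 1 + ρ) (+-comm z 1) (m≤m+n (z + 1) ρ))
    z+1+ρ≡n+p : z + 1 + ρ ≡ n + p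
    z+1+ρ≡n+p with z + 1 + ρ <? n
    ... | yes small = ⊥-elim (<⇒≢ p<z+1+ρ (sym (≈⇒≡ small p<n z+1+ρ≈p)))
    ... | no large  = ≈⇒≡n+ (≮⇒≥ large) (+-mono-≤-< (subst (_≤ n) (+-comm 1 z) (R^<n i c<n)) (≤-<-trans (m∸n≤m r (fib b)) r<n)) p<n z+1+ρ≈p

  +p<n-from-residue : ∀ {x z r b} → x < n → z < n → r < n → x + p ≈ r → z + 1 + r ≡ n + p + fib b → x + p < n
  +p<n-from-residue {x} {z} {r} {b} x<n z<n r<n x+p≈r e with x + p <? n
  ... | yes x+p<n = x+p<n
  ... | no x+p≮n = ⊥-elim (<⇒≱ (+-mono-<-≤ x<n (subst (_≤ n) (+-comm 1 z) z<n))
                               (subst (n + n ≤_) (sym x+z+1≡2n+F) (m≤m+n (n + n) (fib b))))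
    where
    x+p≡n+r : x + p ≡ n + r
    x+p≡n+r = ≈⇒≡n+ (≮⇒≥ x+p≮n) (+-mono-< x<n p<n) r<n x+p≈r
    regroup : ∀ x z p r → x + (z + 1) + (p + r) ≡ (x + p) + (z + 1 + r)
    regroup = solve-∀
    regroup′ : ∀ n r p f → n + r + (n + p + f) ≡ n + n + f + (p + r)
    regroup′ = solve-∀
    x+z+1≡2n+F : x + (z + 1) ≡ n + n + fib b
    x+z+1≡2n+F = +-cancelʳ-≡ (p + r) _ _
      (trans (regroup x z p r) (trans (cong₂ _+_ x+p≡n+r e) (regroup′ n r p (fib b))))

  separated-from-residue : ∀ {z r b} s → z < n → p ≤ z → 0 < fib b → r < n →
    (2 + s) * p ≈ r → z + 1 + r ≡ n + p + fib b → R^ s p < q × q ≤ R^ s p + (z ∸ p)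
  separated-from-residue {z} {r} {b} s z<n p≤z 0<F r<n [2+s]p≈r e = x<q , q≤x+[z∸p]
    where
    x = R^ s p
    x+p≈r : x + p ≈ r
    x+p≈r = begin
      x + p              ≈⟨ +-congʳ p (R^≈ s p<n) ⟩
      p + s * p + p      ≡⟨ regroup p s ⟩
      (2 + s) * p        ≈⟨ [2+s]p≈r ⟩
      r                  ∎
      where
      open ≈-Reasoning
      regroup : ∀ p s → p + s * p + p ≡ (2 + s) * p
      regroup = solve-∀
    x+p<n : x + p < n
    x+p<n = +p<n-from-residue {b = b} (R^<n s p<n) z<n r<n x+p≈r e
    x<q : x < q
    x<q = +-cancelʳ-< p x q x+p<n
    x+z+1≡n+F : x + z + 1 ≡ n + fib b
    x+z+1≡n+F = +-cancelʳ-≡ p _ _ (begin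
      x + z + 1 + p      ≡⟨ regroup x z p ⟩
      z + 1 + (x + p)    ≡⟨ cong (z + 1 +_) (≈⇒≡ x+p<n r<n x+p≈r) ⟩
      z + 1 + r          ≡⟨ e ⟩
      n + p + fib b      ≡⟨ regroup′ n p (fib b) ⟩
      n + fib b + p      ∎)
      where
      open ≡-Reasoning
      regroup : ∀ x z p → x + z + 1 + p ≡ z + 1 + (x + p)
      regroup = solve-∀
      regroup′ : ∀ n p f → n + p + f ≡ n + f + p
      regroup′ = solve-∀
    q≤x+[z∸p] : q ≤ x + (z ∸ p)
    q≤x+[z∸p] = +-cancelʳ-≤ p q (x + (z ∸ p)) (subst (n ≤_) x+z≡ n≤x+z)
      where
      n≤x+z : n ≤ x + z
      n≤x+z = +-cancelʳ-≤ 1 n (x + z) (subst (n + 1 ≤_) (sym x+z+1≡n+F) (+-monoʳ-≤ n 0<F))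
      x+z≡ : x + z ≡ x + (z ∸ p) + p
      x+z≡ = trans (cong (x +_) (sym (m∸n+n≡m p≤z))) (sym (+-assoc x (z ∸ p) p))

  residue-of-long-suffix : ∀ {i ℓ u b} m″ → i + ℓ ≡ n → p ≤ R^ i c → u + b ≡ M → 0 < b → dOcagne⁻ u b →
    ℓ + 1 ≡ fib (2 + u) + m″ → 0 < m″ → m″ < fib (3 + u) →
    ∃ λ r → m″ * p ≈ r × r < n × R^ i c + 1 + r ≡ n + p + fib b
  residue-of-long-suffix {i} {ℓ} {u} {b} m″ i+ℓ≡n p≤z u+b≡M 0<b e⁻ ℓ+1≡A+m″ 0<m″ m″<F
    with far (2 + u) b (cong (2 +_) u+b≡M) 0<m″ m″<F
  ... | J , r , eJ , F≤r , r+F≤n =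
    r , (0 , J , trans (+-identityʳ _) (trans eJ (+-comm (J * n) r))) , r<n ,
    R^c+1+r≡n+p+fib {i} {ℓ} {u} {b} {m″} {J} {r} i+ℓ≡n p≤z u+b≡M e⁻ ℓ+1≡A+m″ eJ F≤r r<n
    where
    r<n : r < n
    r<n = <-≤-trans (m<m+n r (0<fib 0<b)) r+F≤n

  ¬separated-long : ∀ {i ℓ u b} m″ → i + ℓ ≡ n → p ≤ R^ i c → u + b ≡ M → 0 < b → dOcagne⁻ u b →
    ℓ + 1 ≡ fib (2 + u) + m″ → 0 < m″ → m″ < fib (3 + u) → ¬ ¬ Separated ℓ p (R^ i c ∸ p)
  ¬separated-long {i} {ℓ} {u} {b} (suc zero) i+ℓ≡n p≤z u+b≡M 0<b e⁻ ℓ+1≡A+m″ 0<m″ m″<F _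
    with residue-of-long-suffix 1 i+ℓ≡n p≤z u+b≡M 0<b e⁻ ℓ+1≡A+m″ 0<m″ m″<F
  ... | r , p≈r , r<n , e = <⇒≱ (R^<n i c<n) (+-cancelʳ-≤ 1 n (R^ i c) n+1≤z+1)
    where
    p≡r : p ≡ r
    p≡r = ≈⇒≡ p<n r<n (≈-trans (≈-reflexive (sym (+-identityʳ p))) p≈r)
    n+1≤z+1 : n + 1 ≤ R^ i c + 1
    n+1≤z+1 = +-cancelʳ-≤ p (n + 1) (R^ i c + 1) (begin
      n + 1 + p          ≡⟨ +-assoc n 1 p ⟩
      n + (1 + p)        ≤⟨ +-monoʳ-≤ n (+-monoˡ-≤ p (0<fib 0<b)) ⟩
      n + (fib b + p)    ≡⟨ trans (cong (n +_) (+-comm (fib b) p)) (sym (+-assoc n p (fib b))) ⟩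
      n + p + fib b      ≡⟨ trans (sym e) (cong (R^ i c + 1 +_) (sym p≡r)) ⟩
      R^ i c + 1 + p     ∎)
      where open ≤-Reasoning
  ¬separated-long {i} {ℓ} {u} {b} (suc (suc s)) i+ℓ≡n p≤z u+b≡M 0<b e⁻ ℓ+1≡A+m″ 0<m″ m″<F ¬sep
    with residue-of-long-suffix (2 + s) i+ℓ≡n p≤z u+b≡M 0<b e⁻ ℓ+1≡A+m″ 0<m″ m″<F
  ... | r , [2+s]p≈r , r<n , e =
    ¬sep (s , s<ℓ , separated-from-residue {R^ i c} {r} {b} s (R^<n i c<n) p≤z (0<fib 0<b) r<n [2+s]p≈r e)
    where
    s<ℓ : s < ℓ
    s<ℓ = ≤-trans (n≤1+n (suc s)) (+-cancelʳ-≤ 1 (2 + s) ℓ (subst (_≤ ℓ + 1) (+-comm 1 (2 + s))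
            (subst (3 + s ≤_) (sym ℓ+1≡A+m″) (+-monoˡ-≤ (2 + s) (0<fib-suc (suc u))))))

  ¬separated-oddGap : ∀ i ℓ k → i + ℓ ≡ n → 0 < i → p ≤ R^ i c → ¬ Separated ℓ p (R^ i c ∸ p) →
    fib (3 + (k + k)) < ℓ + 1 → ℓ + 1 < fib (5 + (k + k)) → ⊥
  ¬separated-oddGap i ℓ k i+ℓ≡n 0<i p≤z ¬sep A<ℓ+1 ℓ+1<F =
    ¬separated-long (ℓ + 1 ∸ A) i+ℓ≡n p≤z u+b≡M 0<b e⁻ ℓ+1≡A+m″ 0<m″ m″<F ¬sep
    where
    u = 1 + (k + k)
    A = fib (2 + u)
    ℓ+1≡A+m″ : ℓ + 1 ≡ A + (ℓ + 1 ∸ A)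
    ℓ+1≡A+m″ = sym (m+[n∸m]≡n (<⇒≤ A<ℓ+1))
    0<m″ : 0 < ℓ + 1 ∸ A
    0<m″ = m<n⇒0<n∸m A<ℓ+1
    m″<F : ℓ + 1 ∸ A < fib (3 + u)
    m″<F = +-cancelˡ-< A _ _ (subst₂ _<_ ℓ+1≡A+m″ (+-comm (fib (3 + u)) A) ℓ+1<F)
    ℓ+1≤n : ℓ + 1 ≤ n
    ℓ+1≤n = subst (_≤ n) (+-comm 1 ℓ) (subst (suc ℓ ≤_) i+ℓ≡n (+-monoˡ-≤ ℓ 0<i))
    u<M : u < M
    u<M = ≤-pred (≤-pred (fib-cancel-< (<-≤-trans A<ℓ+1 ℓ+1≤n)))
    b = M ∸ u
    u+b≡M : u + b ≡ M
    u+b≡M = m+[n∸m]≡n (<⇒≤ u<M)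
    0<b : 0 < b
    0<b = m<n⇒0<n∸m u<M
    e⁻ : dOcagne⁻ u b
    e⁻ = subst (λ B → if B then dOcagne⁺ u b else dOcagne⁻ u b) (cong not (even-double k)) (fib-dOcagne u b)

  ¬separated⇒fib : ∀ i ℓ → i + ℓ ≡ n → 0 < i → 0 < ℓ → p ≤ R^ i c → ¬ Separated ℓ p (R^ i c ∸ p) →
    ∃ λ k → ℓ + 1 ≡ fib (1 + (k + k)) × 1 + (k + k) ≤ 2 + M
  ¬separated⇒fib i ℓ i+ℓ≡n 0<i 0<ℓ p≤z ¬sep with fib-bracket (ℓ + 1) (m≤n+m 1 ℓ)
  ... | k , lo , hi with fib (1 + (k + k)) ≟ ℓ + 1
  ...   | yes F≡ℓ+1 = k , sym F≡ℓ+1 , ≮⇒≥ λ 2+M<1+2k →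
          <⇒≱ (fib-strictMono (s≤s (s≤s z≤n)) 2+M<1+2k) (subst (_≤ n) (sym F≡ℓ+1) ℓ+1≤n)
    where
    ℓ+1≤n : ℓ + 1 ≤ n
    ℓ+1≤n = subst (_≤ n) (+-comm 1 ℓ) (subst (suc ℓ ≤_) i+ℓ≡n (+-monoˡ-≤ ℓ 0<i))
  ...   | no F≢ℓ+1 = ⊥-elim (strictly-between k (≤∧≢⇒< lo F≢ℓ+1) hi)
    where
    strictly-between : ∀ k → fib (1 + (k + k)) < ℓ + 1 → ℓ + 1 < fib (3 + (k + k)) → ⊥
    strictly-between zero    _   ℓ+1<2 = <⇒≱ ℓ+1<2 (+-monoˡ-≤ 1 0<ℓ)
    strictly-between (suc k) lo′ hi′ rewrite +-suc k k = ¬separated-oddGap i ℓ k i+ℓ≡n 0<i p≤z ¬sep lo′ hi′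

  T : List ℕ
  T = coding n p

  refLabel : List ℕ → ℕ
  refLabel x with T Lexˡ.≤? x
  ... | yes _ = 1
  ... | no  _ = 2

  refLabel-≥T : ∀ {x} → T ≤ˡ x → refLabel x ≡ 1
  refLabel-≥T {x} T≤x with T Lexˡ.≤? x
  ... | yes _  = refl
  ... | no T≰x = ⊥-elim (T≰x T≤x)

  refLabel-≱T : ∀ {x} → ¬ T ≤ˡ x → refLabel x ≡ 2
  refLabel-≱T {x} T≰x with T Lexˡ.≤? x
  ... | yes T≤x = ⊥-elim (T≰x T≤x)
  ... | no  _   = refl

  refLabel-1or2 : ∀ x → refLabel x ≡ 1 ⊎ refLabel x ≡ 2
  refLabel-1or2 x with T Lexˡ.≤? x
  ... | yes _ = inj₁ refl
  ... | no  _ = inj₂ refl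

  refLabel-mono : ∀ {x y} → x ≤ˡ y → refLabel y ≡ 2 → refLabel x ≡ 2
  refLabel-mono {x} {y} x≤y refLabel-y≡2 with T Lexˡ.≤? x
  ... | no  _   = refl
  ... | yes T≤x with () ← trans (sym (refLabel-≥T (Lexˡ.trans T≤x x≤y))) refLabel-y≡2

  mismatchAt : ℕ → ℕ
  mismatchAt i = jump (lastChar (rotation i W)) (refLabel (rotation i W))

  K : List ℕ
  K = 0 ∷ n ∷ map (λ k → suc n ∸ fib (1 + (k + k))) (upTo (3 + M))

  fib-suffix∈K : ∀ i ℓ k → i + ℓ ≡ n → ℓ + 1 ≡ fib (1 + (k + k)) → 1 + (k + k) ≤ 2 + M → i ∈ K
  fib-suffix∈K i ℓ k i+ℓ≡n ℓ+1≡F 1+2k≤2+M = there (there (subst (_∈ _) i≡ (∈-map⁺ _ (∈-upTo⁺ k<3+M))))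
    where
    i≡ : suc n ∸ fib (1 + (k + k)) ≡ i
    i≡ = begin
      suc n ∸ fib (1 + (k + k))    ≡⟨ cong₂ (λ a b → suc a ∸ b) (sym i+ℓ≡n) (sym ℓ+1≡F) ⟩
      suc (i + ℓ) ∸ (ℓ + 1)        ≡⟨ cong (_∸ (ℓ + 1)) (trans (sym (+-suc i ℓ)) (cong (i +_) (+-comm 1 ℓ))) ⟩
      i + (ℓ + 1) ∸ (ℓ + 1)        ≡⟨ m+n∸n≡m i (ℓ + 1) ⟩
      i                            ∎
      where open ≡-Reasoning
    k<3+M : k < 3 + M
    k<3+M = s≤s (≤-trans (m≤m+n k k) (≤-pred (≤-trans 1+2k≤2+M (n≤1+n (2 + M)))))

  rotation-W-<ˡ-T : ∀ i ℓ → i + ℓ ≡ n → 0 < i → R^ i c < p → rotation i W <ˡ T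
  rotation-W-<ˡ-T i ℓ i+ℓ≡n 0<i z<p = subst₂ _<ˡ_ (sym (rotation-W i ℓ i+ℓ≡n)) (List.++-identityʳ T)
    (coding-$-<ˡ ℓ n (coding i c) [] (<⇒≤ z<p) (subst (ℓ <_) i+ℓ≡n (m<n+m ℓ 0<i)))

  separated⇒T-<ˡ-rotation-W : ∀ i ℓ → i + ℓ ≡ n → p ≤ R^ i c → Separated ℓ p (R^ i c ∸ p) → T <ˡ rotation i W
  separated⇒T-<ˡ-rotation-W i ℓ i+ℓ≡n p≤z sep =
    subst₂ _<ˡ_ T≡ rot≡ (coding-<ˡ-separated ℓ p (R^ i c ∸ p) (coding i (R^ ℓ p)) (0 ∷ coding i c) sep)
    where
    T≡ : coding ℓ p ++ coding i (R^ ℓ p) ≡ T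
    T≡ = trans (sym (coding-+ ℓ i p)) (cong (λ L → coding L p) (trans (+-comm ℓ i) i+ℓ≡n))
    rot≡ : coding ℓ (p + (R^ i c ∸ p)) ++ 0 ∷ coding i c ≡ rotation i W
    rot≡ = trans (cong (λ z → coding ℓ z ++ 0 ∷ coding i c) (m+[n∸m]≡n p≤z)) (sym (rotation-W i ℓ i+ℓ≡n))

  mismatchAt-inner : ∀ i ℓ → i + ℓ ≡ n → 0 < i → 0 < ℓ → mismatchAt i ≡ 0 ⊎ i ∈ K
  mismatchAt-inner i ℓ i+ℓ≡n 0<i 0<ℓ with R^ i c <? p
  ... | yes z<p = inj₁ (subst₂ (λ a b → jump a b ≡ 0) (sym (lastChar-rotation-W-<p i ℓ i+ℓ≡n 0<i z<p))
                                 (sym (refLabel-≱T T≰rot)) (jump-refl 2))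
    where
    T≰rot : ¬ T ≤ˡ rotation i W
    T≰rot T≤rot = ≤ˡ⇒≯ˡ T≤rot (rotation-W-<ˡ-T i ℓ i+ℓ≡n 0<i z<p)
  ... | no z≮p = above-p (T Lexˡ.≤? rotation i W)
    where
    p≤z : p ≤ R^ i c
    p≤z = ≮⇒≥ z≮p
    above-p : Dec (T ≤ˡ rotation i W) → mismatchAt i ≡ 0 ⊎ i ∈ K
    above-p (yes T≤rot) = inj₁ (subst₂ (λ a b → jump a b ≡ 0) (sym (lastChar-rotation-W-≥p i ℓ i+ℓ≡n 0<i p≤z))
                                        (sym (refLabel-≥T T≤rot)) (jump-refl 1))
    above-p (no T≰rot) with ¬separated⇒fib i ℓ i+ℓ≡n 0<i 0<ℓ p≤z
                              (λ sep → T≰rot (<ˡ⇒≤ˡ (separated⇒T-<ˡ-rotation-W i ℓ i+ℓ≡n p≤z sep)))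
    ... | k , ℓ+1≡F , 1+2k≤2+M = inj₂ (fib-suffix∈K i ℓ k i+ℓ≡n ℓ+1≡F 1+2k≤2+M)

  length-K : length K ≡ 5 + M
  length-K = cong (2 +_) (trans (List.length-map _ (upTo (3 + M))) (List.length-upTo (3 + M)))

  mismatchAt-support : ∀ i → i < suc n → mismatchAt i ≡ 0 ⊎ i ∈ K
  mismatchAt-support zero    _ = inj₂ (here refl)
  mismatchAt-support (suc i) i<1+n with suc i ≟ n
  ... | yes 1+i≡n = inj₂ (there (here 1+i≡n))
  ... | no 1+i≢n  = mismatchAt-inner (suc i) (n ∸ suc i) (m+[n∸m]≡n (<⇒≤ 1+i<n)) z<s (m<n⇒0<n∸m 1+i<n)
    where
    1+i<n : suc i < n
    1+i<n = ≤∧≢⇒< (≤-pred i<1+n) 1+i≢n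

  mismatches-Lw : mismatches lastChar refLabel Lw ≤ 5 + M
  mismatches-Lw = begin
    mismatches lastChar refLabel Lw        ≡⟨ mismatches-sort-conjugates lastChar refLabel W ⟩
    sum (applyUpTo mismatchAt (length W))  ≡⟨ cong (λ m → sum (applyUpTo mismatchAt m)) length-W ⟩
    sum (applyUpTo mismatchAt (suc n))     ≤⟨ sum-applyUpTo≤length mismatchAt (suc n) (λ i → jump≤1 _ _) mismatchAt-support ⟩
    length K                               ≡⟨ length-K ⟩
    5 + M                                  ∎
    where open ≤-Reasoning

  r$≤ : runs (map lastChar Lw) ≤ 2 + 2 * (5 + M)
  r$≤ = ≤-trans (runs-map-≤-mismatches lastChar refLabel Lw)
          (+-mono-≤ (runs-map-sorted-twoValued refLabel (sort-↗ (conjugates W)) (λ {y} _ → swap (refLabel-1or2 y))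
                                                 (λ _ _ → refLabel-mono))
                    (*-monoʳ-≤ 2 mismatches-Lw))

  v : Word 2
  v = map toFin2 V

  encode-v : encode v ≡ V
  encode-v = encode-map-toFin2 (coding-letters n c)

  r≡ : r v ≡ runs (map lastChar Lv)
  r≡ = cong (λ w → runs (BWT w)) encode-v

  r$≡ : r$ v ≡ runs (map lastChar Lw)
  r$≡ = cong (λ w → runs (BWT (w ++ [ 0 ]))) encode-v

  length-v : length v ≡ fib (2 + M)
  length-v = trans (List.length-map toFin2 V) (length-coding n c)

  log*r≤4*r$ : ⌊log₂ length v ⌋ * r v ≤ 4 * r$ v
  log*r≤4*r$ rewrite length-v | r≡ | r$≡ = begin
    ⌊log₂ fib (2 + M) ⌋ * runs (map lastChar Lv)   ≤⟨ *-mono-≤ (⌊log₂fib⌋≤ (2 + M)) r≤2 ⟩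
    (2 + M) * 2                                   ≤⟨ [2+M]*2≤4*[M∸2] (≤-trans (m≤m+n 6 2) 8≤M) ⟩
    4 * (M ∸ 2)                                   ≤⟨ *-monoʳ-≤ 4 M∸2≤r$ ⟩
    4 * runs (map lastChar Lw)                    ∎
    where open ≤-Reasoning

  r$≤8*log*r : r$ v ≤ 8 * ⌊log₂ length v ⌋ * r v
  r$≤8*log*r rewrite length-v | r≡ | r$≡ = begin
    runs (map lastChar Lw)                                  ≤⟨ r$≤ ⟩
    2 + 2 * (5 + M)                                         ≤⟨ 2+2*[5+M]≤8*⌊M/2⌋ 8≤M ⟩
    8 * ⌊ M /2⌋                                             ≤⟨ *-monoʳ-≤ 8 (⌊n/2⌋≤⌊log₂fib[2+n]⌋ M) ⟩
    8 * ⌊log₂ fib (2 + M) ⌋                                 ≡⟨ *-identityʳ _ ⟨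
    8 * ⌊log₂ fib (2 + M) ⌋ * 1                             ≤⟨ *-monoʳ-≤ (8 * ⌊log₂ fib (2 + M) ⌋) 0<r ⟩
    8 * ⌊log₂ fib (2 + M) ⌋ * runs (map lastChar Lv)        ∎
    where open ≤-Reasoning

module Family (k : ℕ) = FibonacciWord (8 + k) (m≤m+n 8 k)

proposition13 : Σ ℕ λ σ → Σ (ℕ → Word σ) λ v → Σ ℕ λ a → Σ ℕ λ c →
    (1 ≤ a) × (1 ≤ c) ×
    ((k : ℕ) → length (v k) < length (v (suc k))) ×
    ((k : ℕ) → (⌊log₂ length (v k) ⌋ * r (v k) ≤ a * r$ (v k))
             × (r$ (v k) ≤ c * ⌊log₂ length (v k) ⌋ * r (v k)))
proposition13 = 2 , Family.v , 4 , 8 , s≤s z≤n , s≤s z≤n , lengths-increase ,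
  λ k → Family.log*r≤4*r$ k , Family.r$≤8*log*r k
  where
  lengths-increase : ∀ k → length (Family.v k) < length (Family.v (suc k))
  lengths-increase k rewrite Family.length-v k | Family.length-v (suc k) = fib-<-suc {10 + k} (s≤s (s≤s z≤n))
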